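{- In the $\dagger$-PROP $\mathbf{IF}(1,1)$, every morphism $f$ satisfies $f^{T_g}=f^{T_r}=f^\dagger$.
   Context: $\mathbf{IF}(1,1)$ is the $\dagger$-PROP (strict symmetric monoidal $\dagger$-category with objects $\mathbb{N}$, tensor $=$ addition, generating object $1$) generated by green $\mu_g:2\to1,\eta_g:0\to1$ and red $\mu_r:2\to1,\eta_r:0\to1$, with $\delta_c:=\mu_c^\dagger$, $\epsilon_c:=\eta_c^\dagger$ ($c\in\{g,r\}$), subject to: for each colour $(\mu_c,\eta_c)$ is a commutative monoid, $(\mu_c\otimes\mathrm{id}_1)(\mathrm{id}_1\otimes\delta_c)=\delta_c\mu_c=(\mathrm{id}_1\otimes\mu_c)(\delta_c\otimes\mathrm{id}_1)$, $\mu_c\delta_c=\mathrm{id}_1$; the bialgebra laws $\delta_g\mu_r=(\mu_r\otimes\mu_r)(\mathrm{id}_1\otimes\sigma\otimes\mathrm{id}_1)(\delta_g\otimes\delta_g)$, $\delta_g\eta_r=\eta_r\otimes\eta_r$, $\epsilon_g\mu_r=\epsilon_g\otimes\epsilon_g$ (scalar factors built from $\epsilon_g\eta_r$ suppressed by convention); and $\eta_r=(\epsilon_r\otimes\mathrm{id}_1)\delta_g\eta_g$, $\epsilon_g=\epsilon_r\mu_r(\mathrm{id}_1\otimes\eta_g)$. For $c\in\{g,r\}$: $d_c:=\delta_c\eta_c$, $e_c:=d_c^\dagger$; $d_c^{(n)}:0\to 2n$ is the tensor of $n$ copies of $d_c$ reordered so wire $i$ is paired with wire $n+i$, $e_c^{(n)}:=(d_c^{(n)})^\dagger$;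 for $f:n\to m$, $f^{T_c}:=(e_c^{(m)}\otimes\mathrm{id}_n)\circ(\mathrm{id}_m\otimes f\otimes\mathrm{id}_n)\circ(\mathrm{id}_m\otimes d_c^{(n)}):m\to n$. -}

module Defs where

open import Data.Nat using (ℕ; zero; suc; _+_)
open import Data.Nat.Properties using (+-assoc; +-identityʳ; +-suc; +-comm)
open import Data.Product using (_×_)
open import Relation.Binary.PropositionalEquality using (_≡_; refl; sym; trans; cong)

data Col : Set where
  g r : Col

-- Raw terms of the free dagger-PROP on the generators μ_c : 2 → 1, η_c : 0 → 1.
-- Tm n m is the type of (formal) morphisms n → m.
infixr 9 _∘_
infixr 10 _⊗_
infix 11 _†

data Tm : ℕ → ℕ → Set where
  id  : (n : ℕ) → Tm n n
  _∘_ : ∀ {n m k} → Tm m k → Tm n m → Tm n k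
  _⊗_ : ∀ {n m n' m'} → Tm n m → Tm n' m' → Tm (n + n') (m + m')
  σ   : (n m : ℕ) → Tm (n + m) (m + n)
  μ   : Col → Tm 2 1
  η   : Col → Tm 0 1
  _†  : ∀ {n m} → Tm n m → Tm m n

-- Transport along equalities of objects (needed since n + (m + k) and
-- (n + m) + k are only propositionally equal in ℕ).
cast : ∀ {n n' m m'} → n ≡ n' → m ≡ m' → Tm n m → Tm n' m'
cast refl refl f = f

δ : Col → Tm 1 2
δ c = μ c †

ε : Col → Tm 1 0
ε c = η c †

-- Equations of IF(1,1): the congruence generated by the axioms of a strict
-- symmetric monoidal dagger-category and the defining relations.
infix 4 _≈_
data _≈_ : ∀ {n m} → Tm n m → Tm n m → Set where
  ≈-refl  : ∀ {n m} {f : Tm n m} → f ≈ f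
  ≈-sym   : ∀ {n m} {f f' : Tm n m} → f ≈ f' → f' ≈ f
  ≈-trans : ∀ {n m} {f f' f'' : Tm n m} → f ≈ f' → f' ≈ f'' → f ≈ f''
  ∘-cong  : ∀ {n m k} {f f' : Tm n m} {h h' : Tm m k} → h ≈ h' → f ≈ f' → h ∘ f ≈ h' ∘ f'
  ⊗-cong  : ∀ {n m n' m'} {f f' : Tm n m} {h h' : Tm n' m'} → f ≈ f' → h ≈ h' → f ⊗ h ≈ f' ⊗ h'
  †-cong  : ∀ {n m} {f f' : Tm n m} → f ≈ f' → f † ≈ f' †
  idˡ     : ∀ {n m} (f : Tm n m) → id m ∘ f ≈ f
  idʳ     : ∀ {n m} (f : Tm n m) → f ∘ id n ≈ f
  ∘-assoc : ∀ {n m k l} (h : Tm k l) (g' : Tm m k) (f : Tm n m) → (h ∘ g') ∘ f ≈ h ∘ (g' ∘ f)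
  ⊗-id    : ∀ n m → id n ⊗ id m ≈ id (n + m)
  interchange : ∀ {n m k n' m' k'} (h : Tm m k) (f : Tm n m) (h' : Tm m' k') (f' : Tm n' m') →
                (h ∘ f) ⊗ (h' ∘ f') ≈ (h ⊗ h') ∘ (f ⊗ f')
  ⊗-assoc : ∀ {a b c a' b' c'} (f : Tm a a') (h : Tm b b') (k : Tm c c') →
            cast (+-assoc a b c) (+-assoc a' b' c') ((f ⊗ h) ⊗ k) ≈ f ⊗ (h ⊗ k)
  ⊗-unitˡ : ∀ {n m} (f : Tm n m) → id 0 ⊗ f ≈ f
  ⊗-unitʳ : ∀ {n m} (f : Tm n m) → cast (+-identityʳ n) (+-identityʳ m) (f ⊗ id 0) ≈ f
  σ-natural : ∀ {n m n' m'} (f : Tm n m) (h : Tm n' m') → σ m m' ∘ (f ⊗ h) ≈ (h ⊗ f) ∘ σ n n'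
  σ-inv     : ∀ n m → σ m n ∘ σ n m ≈ id (n + m)
  σ-unit    : ∀ n → cast refl (+-identityʳ n) (σ 0 n) ≈ id n
  σ-hexˡ    : ∀ n m k →
              σ n (m + k) ≈
              cast refl (sym (+-assoc m k n))
                ((id m ⊗ σ n k) ∘ cast (+-assoc n m k) (+-assoc m n k) (σ n m ⊗ id k))
  σ-hexʳ    : ∀ n m k →
              cast (+-assoc n m k) refl (σ (n + m) k) ≈
              (cast (+-assoc n k m) (+-assoc k n m) (σ n k ⊗ id m) ∘ (id n ⊗ σ m k))
  †-invol : ∀ {n m} (f : Tm n m) → (f †) † ≈ f
  †-∘     : ∀ {n m k} (h : Tm m k) (f : Tm n m) → (h ∘ f) † ≈ f † ∘ h †
  †-⊗     : ∀ {n m n' m'} (f : Tm n m) (h : Tm n' m') → (f ⊗ h) † ≈ f † ⊗ h †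
  †-id    : ∀ n → id n † ≈ id n
  †-σ     : ∀ n m → σ n m † ≈ σ m n
  μ-assoc : ∀ c → μ c ∘ (μ c ⊗ id 1) ≈ μ c ∘ (id 1 ⊗ μ c)
  μ-unit  : ∀ c → μ c ∘ (η c ⊗ id 1) ≈ id 1
  μ-comm  : ∀ c → μ c ∘ σ 1 1 ≈ μ c
  frobˡ   : ∀ c → (μ c ⊗ id 1) ∘ (id 1 ⊗ δ c) ≈ δ c ∘ μ c
  frobʳ   : ∀ c → δ c ∘ μ c ≈ (id 1 ⊗ μ c) ∘ (δ c ⊗ id 1)
  special : ∀ c → μ c ∘ δ c ≈ id 1
  -- bialgebra laws (scalars suppressed)
  bialg   : δ g ∘ μ r ≈ (μ r ⊗ μ r) ∘ ((id 1 ⊗ σ 1 1) ⊗ id 1) ∘ (δ g ⊗ δ g)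
  copy-η  : δ g ∘ η r ≈ η r ⊗ η r
  del-μ   : ε g ∘ μ r ≈ ε g ⊗ ε g
  ηr-def  : η r ≈ (ε r ⊗ id 1) ∘ δ g ∘ η g
  εg-def  : ε g ≈ ε r ∘ μ r ∘ (id 1 ⊗ η g)

d : Col → Tm 0 2
d c = δ c ∘ η c

private
  shape : ∀ n → 1 + ((n + 1) + n) ≡ suc n + suc n
  shape n = cong suc (trans (+-assoc n 1 n) refl)

-- d^{(n)} : 0 → n + n, wire i paired with wire n + i
dⁿ : Col → (n : ℕ) → Tm 0 (n + n)
dⁿ c zero    = id 0
dⁿ c (suc n) = cast refl (shape n) ((id 1 ⊗ (σ 1 n ⊗ id n)) ∘ (d c ⊗ dⁿ c n))

eⁿ : Col → (n : ℕ) → Tm (n + n) 0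
eⁿ c n = dⁿ c n †

transpose : Col → ∀ {n m} → Tm n m → Tm m n
transpose c {n} {m} f =
  cast (+-identityʳ m) refl
    ((eⁿ c m ⊗ id n)
     ∘ cast refl (sym (+-assoc m m n)) (id m ⊗ (f ⊗ id n))
     ∘ (id m ⊗ dⁿ c n))

module Submission where

-- Fix a colour c.  Say that f : n → m slides along the c-cups when f applied to
-- the first legs of the cup d^{(n)} equals f† applied to the second legs of d^{(m)}.
-- By the snake equation for d^{(n)} (proved by induction on n) the transpose of a
-- sliding morphism is its dagger.  Sliding is preserved by composition, tensor
-- (via the decomposition of d^{(a+b)} into d^{(a)} and d^{(b)}), symmetries and,
-- since the cups are symmetric, by the dagger; so by induction on terms it
-- suffices that the generators μ and η of both colours slide.  For the colour of
-- the cup this follows from the Frobenius laws.  For the other colour we use that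
-- the two colours form a commutative Hopf algebra: the antipode, a wire bent by a
-- cup of one colour and a cap of the other, turns one cup into the other and is a
-- homomorphism for the multiplication (by uniqueness of convolution inverses).

open import Defs
open import Data.Product using (_×_; _,_; proj₁; proj₂)
open import Data.Nat using (ℕ; zero; suc; _+_; _≟_)
open import Data.Nat.Properties using (+-assoc; +-identityʳ; +-cancelˡ-≡; +-cancelʳ-≡)
open import Relation.Binary.PropositionalEquality using (_≡_; refl; sym; trans; cong; cong₂)
open import Relation.Nullary.Decidable using (recompute)
open import Data.Nat.Tactic.RingSolver using (solve-∀)

infix  1 begin_
infixr 2 _≈⟨_⟩_ _≈˘⟨_⟩_
infix  3 _∎

begin_ : ∀ {n m} {f h : Tm n m} → f ≈ h → f ≈ h
begin p = p

_≈⟨_⟩_ : ∀ {n m} (f : Tm n m) {h k : Tm n m} → f ≈ h → h ≈ k → f ≈ k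
_ ≈⟨ p ⟩ q = ≈-trans p q

_≈˘⟨_⟩_ : ∀ {n m} (f : Tm n m) {h k : Tm n m} → h ≈ f → h ≈ k → f ≈ k
_ ≈˘⟨ p ⟩ q = ≈-trans (≈-sym p) q

_∎ : ∀ {n m} (f : Tm n m) → f ≈ f
_ ∎ = ≈-refl

rfl : ∀ {n m} {f : Tm n m} → f ≈ f
rfl = ≈-refl

infixr 4 _⟩∘⟨_ _⟩⊗⟨_
_⟩∘⟨_ : ∀ {n m k} {f f' : Tm n m} {h h' : Tm m k} → h ≈ h' → f ≈ f' → h ∘ f ≈ h' ∘ f'
_⟩∘⟨_ = ∘-cong
_⟩⊗⟨_ : ∀ {n m n' m'} {f f' : Tm n m} {h h' : Tm n' m'} → f ≈ f' → h ≈ h' → f ⊗ h ≈ f' ⊗ h'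
_⟩⊗⟨_ = ⊗-cong

assoc : ∀ {n m k l} {h : Tm k l} {g' : Tm m k} {f : Tm n m} → (h ∘ g') ∘ f ≈ h ∘ (g' ∘ f)
assoc = ∘-assoc _ _ _

assoc˘ : ∀ {n m k l} {h : Tm k l} {g' : Tm m k} {f : Tm n m} → h ∘ (g' ∘ f) ≈ (h ∘ g') ∘ f
assoc˘ = ≈-sym assoc

pullˡ : ∀ {n m k l} {h : Tm k l} {g' : Tm m k} {f : Tm n m} {x : Tm m l} → h ∘ g' ≈ x → h ∘ (g' ∘ f) ≈ x ∘ f
pullˡ p = ≈-trans assoc˘ (p ⟩∘⟨ rfl)

idl : ∀ {n m} {f : Tm n m} → id m ∘ f ≈ f
idl = idˡ _

idr : ∀ {n m} {f : Tm n m} → f ∘ id n ≈ f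
idr = idʳ _

ich : ∀ {n m k n' m' k'} {h : Tm m k} {f : Tm n m} {h' : Tm m' k'} {f' : Tm n' m'} →
      (h ∘ f) ⊗ (h' ∘ f') ≈ (h ⊗ h') ∘ (f ⊗ f')
ich = interchange _ _ _ _

ich˘ : ∀ {n m k n' m' k'} {h : Tm m k} {f : Tm n m} {h' : Tm m' k'} {f' : Tm n' m'} →
       (h ⊗ h') ∘ (f ⊗ f') ≈ (h ∘ f) ⊗ (h' ∘ f')
ich˘ = ≈-sym ich

idid : ∀ {a b} → id a ⊗ id b ≈ id (a + b)
idid = ⊗-id _ _

splitL : ∀ {n m n' m'} {f : Tm n m} {h : Tm n' m'} → f ⊗ h ≈ (f ⊗ id m') ∘ (id n ⊗ h)
splitL = ≈-trans (≈-sym (idr ⟩⊗⟨ idl)) ich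

splitR : ∀ {n m n' m'} {f : Tm n m} {h : Tm n' m'} → f ⊗ h ≈ (id m ⊗ h) ∘ (f ⊗ id n')
splitR = ≈-trans (≈-sym (idl ⟩⊗⟨ idr)) ich

slide : ∀ {n m n' m'} {f : Tm n m} {h : Tm n' m'} → (f ⊗ id m') ∘ (id n ⊗ h) ≈ (id m ⊗ h) ∘ (f ⊗ id n')
slide = ≈-trans (≈-sym splitL) splitR

whiskL : ∀ {k n m l} {h : Tm m l} {f : Tm n m} → id k ⊗ (h ∘ f) ≈ (id k ⊗ h) ∘ (id k ⊗ f)
whiskL = ≈-trans (≈-sym idl ⟩⊗⟨ rfl) ich

whiskR : ∀ {k n m l} {h : Tm m l} {f : Tm n m} → (h ∘ f) ⊗ id k ≈ (h ⊗ id k) ∘ (f ⊗ id k)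
whiskR = ≈-trans (rfl ⟩⊗⟨ ≈-sym idl) ich

fuseʳ : ∀ {n m j k l} {f : Tm n m} {A : Tm k l} {B : Tm j k} → (f ⊗ A) ∘ (id n ⊗ B) ≈ f ⊗ (A ∘ B)
fuseʳ = ≈-trans ich˘ (idr ⟩⊗⟨ rfl)

fuseʳ' : ∀ {n m j k l} {f : Tm n m} {A : Tm k l} {B : Tm j k} → (id m ⊗ A) ∘ (f ⊗ B) ≈ f ⊗ (A ∘ B)
fuseʳ' = ≈-trans ich˘ (idl ⟩⊗⟨ rfl)

fuseˡ : ∀ {n m j k l} {f : Tm n m} {A : Tm k l} {B : Tm j k} → (A ⊗ f) ∘ (B ⊗ id n) ≈ (A ∘ B) ⊗ f
fuseˡ = ≈-trans ich˘ (rfl ⟩⊗⟨ idr)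

fuseˡ' : ∀ {n m j k l} {f : Tm n m} {A : Tm k l} {B : Tm j k} → (A ⊗ id m) ∘ (B ⊗ f) ≈ (A ∘ B) ⊗ f
fuseˡ' = ≈-trans ich˘ (rfl ⟩⊗⟨ idl)

state-ich : ∀ {k j l} {f : Tm 0 k} {h : Tm j l} → (f ⊗ id l) ∘ h ≈ f ⊗ h
state-ich = ≈-trans (rfl ⟩∘⟨ ≈-sym (⊗-unitˡ _)) (≈-sym splitL)

†† : ∀ {n m} {f : Tm n m} → (f †) † ≈ f
†† = †-invol _

dag∘ : ∀ {n m k} {h : Tm m k} {f : Tm n m} → (h ∘ f) † ≈ f † ∘ h †
dag∘ = †-∘ _ _

dag⊗ : ∀ {n m n' m'} {f : Tm n m} {h : Tm n' m'} → (f ⊗ h) † ≈ f † ⊗ h †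
dag⊗ = †-⊗ _ _

dagid : ∀ {n} → id n † ≈ id n
dagid = †-id _

σ† : ∀ {n m} → σ n m † ≈ σ m n
σ† = †-σ _ _

natσ : ∀ {n m n' m'} {f : Tm n m} {h : Tm n' m'} → σ m m' ∘ (f ⊗ h) ≈ (h ⊗ f) ∘ σ n n'
natσ = σ-natural _ _

-- Equality of morphisms whose types are only propositionally equal, e.g.
-- f ⊗ (h ⊗ k) : Tm (a + (b + c)) _ versus (f ⊗ h) ⊗ k : Tm ((a + b) + c) _.
infix 4 _≅_
record _≅_ {n m n' m' : ℕ} (f : Tm n m) (f' : Tm n' m') : Set where
  constructor hq
  field
    pn : n ≡ n'
    pm : m ≡ m'
    eq : cast pn pm f ≈ f'

≈⇒≅ : ∀ {n m} {f f' : Tm n m} → f ≈ f' → f ≅ f'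
≈⇒≅ p = hq refl refl p

≅⇒≈ : ∀ {n m} {f f' : Tm n m} → f ≅ f' → f ≈ f'
≅⇒≈ (hq refl refl p) = p

≅-refl : ∀ {n m} {f : Tm n m} → f ≅ f
≅-refl = hq refl refl ≈-refl

≅-sym : ∀ {n m n' m'} {f : Tm n m} {f' : Tm n' m'} → f ≅ f' → f' ≅ f
≅-sym (hq refl refl p) = hq refl refl (≈-sym p)

≅-trans : ∀ {n m n' m' n'' m''} {f : Tm n m} {f' : Tm n' m'} {f'' : Tm n'' m''} →
          f ≅ f' → f' ≅ f'' → f ≅ f''
≅-trans (hq refl refl p) (hq refl refl q) = hq refl refl (≈-trans p q)

cast≅ : ∀ {n m n' m'} {p : n ≡ n'} {q : m ≡ m'} {f : Tm n m} → cast p q f ≅ f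
cast≅ {p = refl} {refl} = ≅-refl

infix  1 beginH_
infixr 2 _≅⟨_⟩_ _≅˘⟨_⟩_
infix  3 _∎H

beginH_ : ∀ {n m n' m'} {f : Tm n m} {h : Tm n' m'} → f ≅ h → f ≅ h
beginH p = p

_≅⟨_⟩_ : ∀ {n m n' m' n'' m''} (f : Tm n m) {h : Tm n' m'} {k : Tm n'' m''} → f ≅ h → h ≅ k → f ≅ k
_ ≅⟨ p ⟩ q = ≅-trans p q

_≅˘⟨_⟩_ : ∀ {n m n' m' n'' m''} (f : Tm n m) {h : Tm n' m'} {k : Tm n'' m''} → h ≅ f → h ≅ k → f ≅ k
_ ≅˘⟨ p ⟩ q = ≅-trans (≅-sym p) q

_∎H : ∀ {n m} (f : Tm n m) → f ≅ f
_ ∎H = ≅-refl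

∘≅ : ∀ {n m k n' m' k'} {h : Tm m k} {h' : Tm m' k'} {f : Tm n m} {f' : Tm n' m'} →
     h ≅ h' → f ≅ f' → h ∘ f ≅ h' ∘ f'
∘≅ (hq refl refl p) (hq refl refl q) = hq refl refl (∘-cong p q)

⊗≅ : ∀ {a b c d a' b' c' d'} {f : Tm a b} {f' : Tm a' b'} {h : Tm c d} {h' : Tm c' d'} →
     f ≅ f' → h ≅ h' → f ⊗ h ≅ f' ⊗ h'
⊗≅ (hq refl refl p) (hq refl refl q) = hq refl refl (⊗-cong p q)

†≅ : ∀ {n m n' m'} {f : Tm n m} {f' : Tm n' m'} → f ≅ f' → f † ≅ f' †
†≅ (hq refl refl p) = hq refl refl (†-cong p)

id≅ : ∀ {a b} → a ≡ b → id a ≅ id b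
id≅ refl = ≅-refl

assoc⊗ : ∀ {a b c a' b' c'} {f : Tm a a'} {h : Tm b b'} {k : Tm c c'} → (f ⊗ h) ⊗ k ≅ f ⊗ (h ⊗ k)
assoc⊗ {a} {b} {c} {a'} {b'} {c'} {f} {h} {k} = hq (+-assoc a b c) (+-assoc a' b' c') (⊗-assoc f h k)

unitR≅ : ∀ {n m} {f : Tm n m} → f ⊗ id 0 ≅ f
unitR≅ {n} {m} {f} = hq (+-identityʳ n) (+-identityʳ m) (⊗-unitʳ f)

unitL≅ : ∀ {n m} {f : Tm n m} → id 0 ⊗ f ≅ f
unitL≅ {f = f} = ≈⇒≅ (⊗-unitˡ f)

idid≅ : ∀ {a b} → id a ⊗ id b ≅ id (a + b)
idid≅ = ≈⇒≅ idid

idsplit : ∀ {a b} → id (a + b) ≅ id a ⊗ id b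
idsplit = ≅-sym idid≅

id3 : ∀ {a b c} → id a ⊗ (id b ⊗ id c) ≅ id (a + (b + c))
id3 = ≅-trans (⊗≅ ≅-refl idid≅) idid≅

-- The glue is irrelevant (recomputed by decision of ≡ on ℕ), so terms built
-- from different proofs of the same equation are definitionally equal; the
-- definition is opaque so that it is only manipulated through the lemmas below.
glue : ∀ {m m' : ℕ} → .(m ≡ m') → m ≡ m'
glue {m} {m'} p = recompute (m ≟ m') p

opaque
  infixr 9 _∘[_]_
  _∘[_]_ : ∀ {n m m' k} → Tm m' k → .(m ≡ m') → Tm n m → Tm n k
  h ∘[ p ] f = h ∘ cast refl (glue p) f

opaque
  unfolding _∘[_]_

  ∘H : ∀ {n m1 m2 k n' m1' m2' k'} {h : Tm m2 k} {h' : Tm m2' k'} {f : Tm n m1} {f' : Tm n' m1'}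
       .{p : m1 ≡ m2} (H : h ≅ h') (F : f ≅ f') →
       h ∘[ p ] f ≅ h' ∘[ trans (sym (_≅_.pm F)) (trans p (_≅_.pn H)) ] f'
  ∘H {p = p} H F = go (glue p) _ H F
    where
    go : ∀ {n m1 m2 k n' m1' m2' k'} {h : Tm m2 k} {h' : Tm m2' k'} {f : Tm n m1} {f' : Tm n' m1'}
         (q : m1 ≡ m2) (q' : m1' ≡ m2') → h ≅ h' → f ≅ f' → h ∘ cast refl q f ≅ h' ∘ cast refl q' f'
    go refl refl (hq refl refl p) (hq refl refl q) = hq refl refl (∘-cong p q)

  toH : ∀ {n m k} {h : Tm m k} {f : Tm n m} → h ∘ f ≅ h ∘[ refl ] f
  toH {m = m} = go (glue {m} refl)
    where
    go : ∀ {n m k} {h : Tm m k} {f : Tm n m} (e : m ≡ m) → h ∘ f ≅ h ∘ cast refl e f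
    go refl = ≅-refl

  ∘[]-assoc : ∀ {n m1 m2 k1 k2 l} {h : Tm k2 l} {g' : Tm m2 k1} {f : Tm n m1}
              .{p : k1 ≡ k2} .{q : m1 ≡ m2} →
              (h ∘[ p ] g') ∘[ q ] f ≅ h ∘[ p ] (g' ∘[ q ] f)
  ∘[]-assoc {p = p} {q} = go (glue p) (glue q)
    where
    go : ∀ {n m1 m2 k1 k2 l} {h : Tm k2 l} {g' : Tm m2 k1} {f : Tm n m1} (p : k1 ≡ k2) (q : m1 ≡ m2) →
         (h ∘ cast refl p g') ∘ cast refl q f ≅ h ∘ cast refl p (g' ∘ cast refl q f)
    go refl refl = ≈⇒≅ assoc

  ∘[]-idl : ∀ {n m m'} {f : Tm n m} .{p : m ≡ m'} → id m' ∘[ p ] f ≅ f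
  ∘[]-idl {p = p} = go (glue p)
    where
    go : ∀ {n m m'} {f : Tm n m} (p : m ≡ m') → id m' ∘ cast refl p f ≅ f
    go refl = ≈⇒≅ idl

  ∘[]-idr : ∀ {n n' m} {h : Tm n' m} .{p : n ≡ n'} → h ∘[ p ] id n ≅ h
  ∘[]-idr {p = p} = go (glue p)
    where
    go : ∀ {n n' m} {h : Tm n' m} (p : n ≡ n') → h ∘ cast refl p (id n) ≅ h
    go refl = ≈⇒≅ idr

  ichH : ∀ {n m m' k n' l l' k'} {h : Tm m' k} {f : Tm n m} {h' : Tm l' k'} {f' : Tm n' l}
         .{p : m ≡ m'} .{p' : l ≡ l'} →
         (h ∘[ p ] f) ⊗ (h' ∘[ p' ] f') ≅ (h ⊗ h') ∘[ cong₂ _+_ p p' ] (f ⊗ f')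
  ichH {p = p} {p'} = go (glue p) (glue p') (glue (cong₂ _+_ p p'))
    where
    go : ∀ {n m m' k n' l l' k'} {h : Tm m' k} {f : Tm n m} {h' : Tm l' k'} {f' : Tm n' l}
         (p : m ≡ m') (p' : l ≡ l') (q : m + l ≡ m' + l') →
         (h ∘ cast refl p f) ⊗ (h' ∘ cast refl p' f') ≅ (h ⊗ h') ∘ cast refl q (f ⊗ f')
    go refl refl refl = ≈⇒≅ ich

glueR : ∀ {n m k} {h : Tm m k} {f : Tm n m} {X : Tm n k} → h ∘ f ≈ X → h ∘[ refl ] f ≅ X
glueR p = ≅-trans (≅-sym toH) (≈⇒≅ p)

wL : ∀ {a n m1 m2 k} {h : Tm m2 k} {f : Tm n m1} .{p : m1 ≡ m2} →
     id a ⊗ (h ∘[ p ] f) ≅ (id a ⊗ h) ∘[ cong₂ _+_ refl p ] (id a ⊗ f)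
wL {a} {p = p} = ≅-trans (⊗≅ (≅-sym (∘[]-idl {f = id a} {p = refl})) ≅-refl) (ichH {p = refl} {p})

wR : ∀ {a n m1 m2 k} {h : Tm m2 k} {f : Tm n m1} .{p : m1 ≡ m2} →
     (h ∘[ p ] f) ⊗ id a ≅ (h ⊗ id a) ∘[ cong₂ _+_ p refl ] (f ⊗ id a)
wR {a} {p = p} = ≅-trans (⊗≅ ≅-refl (≅-sym (∘[]-idl {f = id a} {p = refl}))) (ichH {p = p} {refl})

wL⁻ : ∀ {a n m1 m2 k} {h : Tm m2 k} {f : Tm n m1} .{p : a + m1 ≡ a + m2} →
      (id a ⊗ h) ∘[ p ] (id a ⊗ f) ≅ id a ⊗ (h ∘[ +-cancelˡ-≡ a _ _ p ] f)
wL⁻ {a} {p = p} = ≅-sym (wL {a} {p = +-cancelˡ-≡ a _ _ p})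

wR⁻ : ∀ {a n m1 m2 k} {h : Tm m2 k} {f : Tm n m1} .{p : m1 + a ≡ m2 + a} →
      (h ⊗ id a) ∘[ p ] (f ⊗ id a) ≅ (h ∘[ +-cancelʳ-≡ a _ _ p ] f) ⊗ id a
wR⁻ {a} {p = p} = ≅-sym (wR {a} {p = +-cancelʳ-≡ a _ _ p})

tensL : ∀ {k n m1 m2 l} {f : Tm 0 k} {Y : Tm m2 l} {Z : Tm n m1} .{p : m1 ≡ m2} →
        f ⊗ (Y ∘[ p ] Z) ≅ (id k ⊗ Y) ∘[ cong₂ _+_ refl p ] (f ⊗ Z)
tensL {f = f} {p = p} = ≅-trans (⊗≅ (≅-sym (∘[]-idl {f = f} {p = refl})) ≅-refl) (ichH {p = refl} {p})

tensR : ∀ {k n m1 m2 l} {f : Tm 0 k} {Y : Tm m2 l} {Z : Tm n m1} .{p : m1 ≡ m2} →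
        (Y ∘[ p ] Z) ⊗ f ≅ (Y ⊗ id k) ∘[ cong₂ _+_ p refl ] (Z ⊗ f)
tensR {f = f} {p = p} = ≅-trans (⊗≅ ≅-refl (≅-sym (∘[]-idl {f = f} {p = refl}))) (ichH {p = p} {refl})

ichR⁻ : ∀ {k j n m1 m2 l} {P : Tm m2 l} {Q : Tm n m1} {R : Tm j k} .{p : m1 + k ≡ m2 + k} →
        (P ⊗ id k) ∘[ p ] (Q ⊗ R) ≅ (P ∘[ +-cancelʳ-≡ k _ _ p ] Q) ⊗ R
ichR⁻ {k} {p = p} = ≅-sym (≅-trans (⊗≅ ≅-refl (≅-sym (∘[]-idl {p = refl}))) (ichH {p = +-cancelʳ-≡ k _ _ p} {refl}))

ichRid⁻ : ∀ {j k n m1 m2 l} {P : Tm m2 l} {Q : Tm n m1} {R : Tm j k} .{p : m1 + j ≡ m2 + j} →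
          (P ⊗ R) ∘[ p ] (Q ⊗ id j) ≅ (P ∘[ +-cancelʳ-≡ j _ _ p ] Q) ⊗ R
ichRid⁻ {j} {p = p} = ≅-sym (≅-trans (⊗≅ ≅-refl (≅-sym (∘[]-idr {p = refl}))) (ichH {p = +-cancelʳ-≡ j _ _ p} {refl}))

fL : ∀ {n m j m1 m2 l} {f : Tm n m} {A : Tm m2 l} {B : Tm j m1} .{p : n + m1 ≡ n + m2} →
     (f ⊗ A) ∘[ p ] (id n ⊗ B) ≅ f ⊗ (A ∘[ +-cancelˡ-≡ n _ _ p ] B)
fL {n} {p = p} = ≅-sym (≅-trans (⊗≅ (≅-sym (∘[]-idr {p = refl})) ≅-refl) (ichH {p = refl} {+-cancelˡ-≡ n _ _ p}))

fR : ∀ {n m j m1 m2 l} {f : Tm n m} {A : Tm m2 l} {B : Tm j m1} .{p : m + m1 ≡ m + m2} →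
     (id m ⊗ A) ∘[ p ] (f ⊗ B) ≅ f ⊗ (A ∘[ +-cancelˡ-≡ m _ _ p ] B)
fR {m = m} {p = p} = ≅-sym (≅-trans (⊗≅ (≅-sym (∘[]-idl {p = refl})) ≅-refl) (ichH {p = refl} {+-cancelˡ-≡ m _ _ p}))

disj1 : ∀ {n m k k'} {f : Tm n m} {h : Tm k k'} → (f ⊗ id k') ∘[ refl ] (id n ⊗ h) ≅ f ⊗ h
disj1 = glueR (≈-sym splitL)

disj2 : ∀ {n m k k'} {f : Tm n m} {h : Tm k k'} → (id m ⊗ h) ∘[ refl ] (f ⊗ id k) ≅ f ⊗ h
disj2 = glueR (≈-sym splitR)

natσH : ∀ {n m n' m'} {f : Tm n m} {h : Tm n' m'} → σ m m' ∘[ refl ] (f ⊗ h) ≅ (h ⊗ f) ∘[ refl ] σ n n'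
natσH = ≅-trans (glueR natσ) toH

σ0≅ : ∀ {n} → σ 0 n ≅ id n
σ0≅ {n} = hq refl (+-identityʳ n) (σ-unit n)

σn0≅ : ∀ {n} → σ n 0 ≅ id n
σn0≅ {n} = beginH
  σ n 0                ≅˘⟨ ≈⇒≅ idl ⟩
  id n ∘ σ n 0         ≅˘⟨ ∘≅ σ0≅ ≅-refl ⟩
  σ 0 n ∘ σ n 0        ≅⟨ ≈⇒≅ (σ-inv n 0) ⟩
  id (n + 0)           ≅⟨ id≅ (+-identityʳ n) ⟩
  id n ∎H

σ10 : σ 1 0 ≈ id 1
σ10 = ≅⇒≈ σn0≅

σ01 : σ 0 1 ≈ id 1
σ01 = ≅⇒≈ σ0≅

σ00 : σ 0 0 ≈ id 0
σ00 = ≅⇒≈ σ0≅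

opaque
  unfolding _∘[_]_

  hexL≅ : ∀ {n m k} → σ n (m + k) ≅ (id m ⊗ σ n k) ∘[ +-assoc m n k ] (σ n m ⊗ id k)
  hexL≅ {n} {m} {k} = ≅-trans (≈⇒≅ (σ-hexˡ n m k))
    (≅-trans cast≅ (go (glue (+-assoc m n k))))
    where
    go : (e : m + n + k ≡ m + (n + k)) → (id m ⊗ σ n k) ∘ cast (+-assoc n m k) (+-assoc m n k) (σ n m ⊗ id k)
                                          ≅ (id m ⊗ σ n k) ∘ cast refl e (σ n m ⊗ id k)
    go e = ∘≅ ≅-refl (≅-trans (cast≅ {p = +-assoc n m k} {+-assoc m n k}) (≅-sym cast≅))

  hexR≅ : ∀ {n m k} → σ (n + m) k ≅ (σ n k ⊗ id m) ∘[ sym (+-assoc n k m) ] (id n ⊗ σ m k)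
  hexR≅ {n} {m} {k} = ≅-trans (≅-sym cast≅)
    (≅-trans (≈⇒≅ (σ-hexʳ n m k)) (∘≅ (cast≅ {p = +-assoc n k m} {+-assoc k n m}) (≅-sym cast≅)))

σ21≈ : σ 2 1 ≈ (σ 1 1 ⊗ id 1) ∘ (id 1 ⊗ σ 1 1)
σ21≈ = ≅⇒≈ (≅-trans (hexR≅ {1} {1} {1}) (≅-sym toH))

σ12≈ : σ 1 2 ≈ (id 1 ⊗ σ 1 1) ∘ (σ 1 1 ⊗ id 1)
σ12≈ = ≅⇒≈ (≅-trans (hexL≅ {1} {1} {1}) (≅-sym toH))

s1 s2 s3 : Tm 4 4
s1 = σ 1 1 ⊗ id 2
s2 = id 1 ⊗ (σ 1 1 ⊗ id 1)
s3 = id 2 ⊗ σ 1 1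

s2-invol : s2 ∘ s2 ≈ id 4
s2-invol = begin
  (id 1 ⊗ (σ 1 1 ⊗ id 1)) ∘ (id 1 ⊗ (σ 1 1 ⊗ id 1)) ≈˘⟨ whiskL ⟩
  id 1 ⊗ ((σ 1 1 ⊗ id 1) ∘ (σ 1 1 ⊗ id 1))           ≈˘⟨ rfl ⟩⊗⟨ whiskR ⟩
  id 1 ⊗ ((σ 1 1 ∘ σ 1 1) ⊗ id 1)                     ≈⟨ rfl ⟩⊗⟨ (σ-inv 1 1 ⟩⊗⟨ rfl) ⟩
  id 1 ⊗ (id 2 ⊗ id 1)                                ≈⟨ ≅⇒≈ id3 ⟩
  id 4 ∎

s3-invol : s3 ∘ s3 ≈ id 4
s3-invol = begin
  (id 2 ⊗ σ 1 1) ∘ (id 2 ⊗ σ 1 1) ≈˘⟨ whiskL ⟩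
  id 2 ⊗ (σ 1 1 ∘ σ 1 1)          ≈⟨ rfl ⟩⊗⟨ σ-inv 1 1 ⟩
  id 2 ⊗ id 2                     ≈⟨ idid ⟩
  id 4 ∎

σ22≈ : σ 2 2 ≈ (s2 ∘ s1) ∘ (s3 ∘ s2)
σ22≈ = begin
  σ 2 2 ≈⟨ ≅⇒≈ (≅-trans (hexR≅ {1} {1} {2}) (≅-sym toH)) ⟩
  (σ 1 2 ⊗ id 1) ∘ (id 1 ⊗ σ 1 2) ≈⟨ (σ12≈ ⟩⊗⟨ rfl) ⟩∘⟨ (rfl ⟩⊗⟨ σ12≈) ⟩
  (((id 1 ⊗ σ 1 1) ∘ (σ 1 1 ⊗ id 1)) ⊗ id 1) ∘ (id 1 ⊗ ((id 1 ⊗ σ 1 1) ∘ (σ 1 1 ⊗ id 1))) ≈⟨ whiskR ⟩∘⟨ whiskL ⟩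
  (((id 1 ⊗ σ 1 1) ⊗ id 1) ∘ ((σ 1 1 ⊗ id 1) ⊗ id 1)) ∘ ((id 1 ⊗ (id 1 ⊗ σ 1 1)) ∘ (id 1 ⊗ (σ 1 1 ⊗ id 1)))
    ≈⟨ (≅⇒≈ assoc⊗ ⟩∘⟨ ≅⇒≈ (≅-trans assoc⊗ (⊗≅ ≅-refl idid≅)))
       ⟩∘⟨ (≅⇒≈ (≅-trans (≅-sym assoc⊗) (⊗≅ idid≅ ≅-refl)) ⟩∘⟨ rfl) ⟩
  (s2 ∘ s1) ∘ (s3 ∘ s2) ∎

cap : Col → Tm 2 0
cap c = ε c ∘ μ c

module Frobenius (c : Col) where

  unitR : μ c ∘ (id 1 ⊗ η c) ≈ id 1
  unitR = begin
    μ c ∘ (id 1 ⊗ η c)           ≈˘⟨ μ-comm c ⟩∘⟨ rfl ⟩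
    (μ c ∘ σ 1 1) ∘ (id 1 ⊗ η c) ≈⟨ assoc ⟩
    μ c ∘ (σ 1 1 ∘ (id 1 ⊗ η c)) ≈⟨ rfl ⟩∘⟨ natσ ⟩
    μ c ∘ ((η c ⊗ id 1) ∘ σ 1 0) ≈⟨ rfl ⟩∘⟨ (rfl ⟩∘⟨ σ10) ⟩
    μ c ∘ ((η c ⊗ id 1) ∘ id 1)  ≈⟨ rfl ⟩∘⟨ idr ⟩
    μ c ∘ (η c ⊗ id 1)           ≈⟨ μ-unit c ⟩
    id 1 ∎

  -- The comonoid laws are the daggers of the monoid laws.
  counitL : (ε c ⊗ id 1) ∘ δ c ≈ id 1
  counitL = begin
    (ε c ⊗ id 1) ∘ δ c   ≈˘⟨ (rfl ⟩⊗⟨ dagid) ⟩∘⟨ rfl ⟩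
    (ε c ⊗ id 1 †) ∘ δ c ≈˘⟨ dag⊗ ⟩∘⟨ rfl ⟩
    (η c ⊗ id 1) † ∘ δ c ≈˘⟨ dag∘ ⟩
    (μ c ∘ (η c ⊗ id 1)) † ≈⟨ †-cong (μ-unit c) ⟩
    id 1 †               ≈⟨ dagid ⟩
    id 1 ∎

  counitR : (id 1 ⊗ ε c) ∘ δ c ≈ id 1
  counitR = begin
    (id 1 ⊗ ε c) ∘ δ c   ≈˘⟨ (dagid ⟩⊗⟨ rfl) ⟩∘⟨ rfl ⟩
    (id 1 † ⊗ ε c) ∘ δ c ≈˘⟨ dag⊗ ⟩∘⟨ rfl ⟩
    (id 1 ⊗ η c) † ∘ δ c ≈˘⟨ dag∘ ⟩
    (μ c ∘ (id 1 ⊗ η c)) † ≈⟨ †-cong unitR ⟩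
    id 1 †               ≈⟨ dagid ⟩
    id 1 ∎

  cocomm : σ 1 1 ∘ δ c ≈ δ c
  cocomm = begin
    σ 1 1 ∘ δ c   ≈˘⟨ σ† ⟩∘⟨ rfl ⟩
    σ 1 1 † ∘ δ c ≈˘⟨ dag∘ ⟩
    (μ c ∘ σ 1 1) † ≈⟨ †-cong (μ-comm c) ⟩
    δ c ∎

  coassoc : (δ c ⊗ id 1) ∘ δ c ≈ (id 1 ⊗ δ c) ∘ δ c
  coassoc = begin
    (δ c ⊗ id 1) ∘ δ c     ≈˘⟨ (rfl ⟩⊗⟨ dagid) ⟩∘⟨ rfl ⟩
    (δ c ⊗ id 1 †) ∘ δ c   ≈˘⟨ dag⊗ ⟩∘⟨ rfl ⟩
    (μ c ⊗ id 1) † ∘ δ c   ≈˘⟨ dag∘ ⟩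
    (μ c ∘ (μ c ⊗ id 1)) † ≈⟨ †-cong (μ-assoc c) ⟩
    (μ c ∘ (id 1 ⊗ μ c)) † ≈⟨ dag∘ ⟩
    (id 1 ⊗ μ c) † ∘ δ c   ≈⟨ dag⊗ ⟩∘⟨ rfl ⟩
    (id 1 † ⊗ δ c) ∘ δ c   ≈⟨ (dagid ⟩⊗⟨ rfl) ⟩∘⟨ rfl ⟩
    (id 1 ⊗ δ c) ∘ δ c ∎

  -- By cocommutativity an effect may be applied to either output of δ.
  effect-swap : ∀ {k : Tm 1 0} → (id 1 ⊗ k) ∘ δ c ≈ (k ⊗ id 1) ∘ δ c
  effect-swap {k} = begin
    (id 1 ⊗ k) ∘ δ c           ≈˘⟨ rfl ⟩∘⟨ cocomm ⟩
    (id 1 ⊗ k) ∘ σ 1 1 ∘ δ c   ≈⟨ assoc˘ ⟩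
    ((id 1 ⊗ k) ∘ σ 1 1) ∘ δ c ≈˘⟨ natσ ⟩∘⟨ rfl ⟩
    (σ 0 1 ∘ (k ⊗ id 1)) ∘ δ c ≈⟨ ≈-trans (σ01 ⟩∘⟨ rfl) idl ⟩∘⟨ rfl ⟩
    (k ⊗ id 1) ∘ δ c ∎

  cup-sym : σ 1 1 ∘ d c ≈ d c
  cup-sym = ≈-trans assoc˘ (cocomm ⟩∘⟨ rfl)

  d†≈cap : d c † ≈ cap c
  d†≈cap = ≈-trans dag∘ (rfl ⟩∘⟨ ††)

  snake₁ : (cap c ⊗ id 1) ∘ (id 1 ⊗ d c) ≈ id 1
  snake₁ = begin
    (cap c ⊗ id 1) ∘ (id 1 ⊗ d c) ≈⟨ whiskR ⟩∘⟨ whiskL ⟩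
    ((ε c ⊗ id 1) ∘ (μ c ⊗ id 1)) ∘ ((id 1 ⊗ δ c) ∘ (id 1 ⊗ η c)) ≈⟨ assoc ⟩
    (ε c ⊗ id 1) ∘ ((μ c ⊗ id 1) ∘ ((id 1 ⊗ δ c) ∘ (id 1 ⊗ η c))) ≈⟨ rfl ⟩∘⟨ pullˡ (frobˡ c) ⟩
    (ε c ⊗ id 1) ∘ ((δ c ∘ μ c) ∘ (id 1 ⊗ η c)) ≈⟨ rfl ⟩∘⟨ assoc ⟩
    (ε c ⊗ id 1) ∘ (δ c ∘ (μ c ∘ (id 1 ⊗ η c))) ≈⟨ pullˡ counitL ⟩
    id 1 ∘ (μ c ∘ (id 1 ⊗ η c)) ≈⟨ idl ⟩
    μ c ∘ (id 1 ⊗ η c)          ≈⟨ unitR ⟩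
    id 1 ∎

  μ-bend : (μ c ⊗ id 1) ∘ (id 1 ⊗ d c) ≈ δ c
  μ-bend = begin
    (μ c ⊗ id 1) ∘ (id 1 ⊗ d c)                ≈⟨ rfl ⟩∘⟨ whiskL ⟩
    (μ c ⊗ id 1) ∘ (id 1 ⊗ δ c) ∘ (id 1 ⊗ η c) ≈⟨ pullˡ (frobˡ c) ⟩
    (δ c ∘ μ c) ∘ (id 1 ⊗ η c)                 ≈⟨ assoc ⟩
    δ c ∘ μ c ∘ (id 1 ⊗ η c)                   ≈⟨ rfl ⟩∘⟨ unitR ⟩
    δ c ∘ id 1                                 ≈⟨ idr ⟩
    δ c ∎

snake-shape : ∀ n → 1 + ((1 + n) + (1 + (n + n))) ≡ 1 + (1 + (n + ((1 + n) + n)))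
snake-shape = solve-∀

module Cups (c : Col) where
  open Frobenius c

  D : (n : ℕ) → Tm 0 (n + n)
  D = dⁿ c

  dⁿ-unfold : ∀ {n} → D (suc n) ≅ (id 1 ⊗ (σ 1 n ⊗ id n)) ∘ (d c ⊗ D n)
  dⁿ-unfold = cast≅

  split-shape : ∀ a b → (a + a) + (b + b) ≡ a + ((a + b) + b)
  split-shape a b = trans (+-assoc a a (b + b)) (cong (a +_) (sym (+-assoc a b b)))

  dⁿ-split : ∀ a b → D (a + b) ≅ (id a ⊗ (σ a b ⊗ id b)) ∘[ split-shape a b ] (D a ⊗ D b)
  dⁿ-split zero b = ≅-sym (beginH
    (id 0 ⊗ (σ 0 b ⊗ id b)) ∘[ split-shape 0 b ] (id 0 ⊗ D b) ≅⟨ ∘H unitL≅ unitL≅ ⟩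
    (σ 0 b ⊗ id b) ∘[ refl ] D b ≅⟨ ∘H (≅-trans (⊗≅ σ0≅ ≅-refl) idid≅) ≅-refl ⟩
    id (b + b) ∘[ refl ] D b ≅⟨ ∘[]-idl ⟩
    D b ∎H)
  dⁿ-split (suc a) b = ≅-trans lhs-normal (≅-sym rhs-normal)
    where
    -- Both sides of the step equal normal-form: the three cups d, d^{(a)}, d^{(b)}
    -- followed by the crossings stage₁ and then stage₂.
    stage₁ : Tm (1 + ((1 + a) + ((a + b) + b))) (1 + ((a + 1) + ((b + a) + b)))
    stage₁ = id 1 ⊗ (σ 1 a ⊗ (σ a b ⊗ id b))
    stage₂ : Tm (1 + (a + ((1 + b) + (a + b)))) (1 + (a + ((b + 1) + (a + b))))
    stage₂ = id 1 ⊗ (id a ⊗ (σ 1 b ⊗ (id a ⊗ id b)))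
    normal-form : Tm 0 (1 + (a + ((b + 1) + (a + b))))
    normal-form = (stage₂ ∘[ _ ] stage₁) ∘[ _ ] (d c ⊗ (D a ⊗ D b))
    lhs-perm : (id 1 ⊗ (σ 1 (a + b) ⊗ id (a + b))) ∘[ _ ] (id 2 ⊗ (id a ⊗ (σ a b ⊗ id b))) ≅ stage₂ ∘[ _ ] stage₁
    lhs-perm = beginH
      (id 1 ⊗ (σ 1 (a + b) ⊗ id (a + b))) ∘[ _ ] (id 2 ⊗ (id a ⊗ (σ a b ⊗ id b)))
        ≅⟨ ∘H (⊗≅ ≅-refl (⊗≅ hexL≅ ≅-refl)) ≅-refl ⟩
      (id 1 ⊗ (((id a ⊗ σ 1 b) ∘[ +-assoc a 1 b ] (σ 1 a ⊗ id b)) ⊗ id (a + b))) ∘[ _ ] (id 2 ⊗ (id a ⊗ (σ a b ⊗ id b)))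
        ≅⟨ ∘H (≅-trans (⊗≅ ≅-refl wR) wL) ≅-refl ⟩
      ((id 1 ⊗ ((id a ⊗ σ 1 b) ⊗ id (a + b))) ∘[ _ ] (id 1 ⊗ ((σ 1 a ⊗ id b) ⊗ id (a + b))))
         ∘[ _ ] (id 2 ⊗ (id a ⊗ (σ a b ⊗ id b)))
        ≅⟨ ∘[]-assoc ⟩
      (id 1 ⊗ ((id a ⊗ σ 1 b) ⊗ id (a + b))) ∘[ _ ] ((id 1 ⊗ ((σ 1 a ⊗ id b) ⊗ id (a + b))) ∘[ _ ] (id 2 ⊗ (id a ⊗ (σ a b ⊗ id b))))
        ≅⟨ ∘H (⊗≅ ≅-refl (≅-trans assoc⊗ (⊗≅ ≅-refl (⊗≅ ≅-refl (idsplit {a} {b}))))) to-stage₁ ⟩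
      stage₂ ∘[ _ ] stage₁ ∎H
      where
      to-stage₁ : (id 1 ⊗ ((σ 1 a ⊗ id b) ⊗ id (a + b))) ∘[ _ ] (id 2 ⊗ (id a ⊗ (σ a b ⊗ id b))) ≅ stage₁
      to-stage₁ = beginH
        (id 1 ⊗ ((σ 1 a ⊗ id b) ⊗ id (a + b))) ∘[ _ ] (id 2 ⊗ (id a ⊗ (σ a b ⊗ id b)))
          ≅⟨ ∘H (⊗≅ ≅-refl (≅-trans assoc⊗ (⊗≅ ≅-refl (≅-trans (⊗≅ ≅-refl (idsplit {a} {b})) id3))))
                (≅-trans (⊗≅ (idsplit {1} {1}) ≅-refl) assoc⊗) ⟩
        (id 1 ⊗ (σ 1 a ⊗ id (b + (a + b)))) ∘[ _ ] (id 1 ⊗ (id 1 ⊗ (id a ⊗ (σ a b ⊗ id b))))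
          ≅⟨ wL⁻ ⟩
        id 1 ⊗ ((σ 1 a ⊗ id (b + (a + b))) ∘[ _ ] (id 1 ⊗ (id a ⊗ (σ a b ⊗ id b))))
          ≅⟨ ⊗≅ ≅-refl (∘H ≅-refl (≅-trans (≅-sym assoc⊗) (⊗≅ idid≅ ≅-refl))) ⟩
        id 1 ⊗ ((σ 1 a ⊗ id (b + (a + b))) ∘[ _ ] (id (1 + a) ⊗ (σ a b ⊗ id b)))
          ≅⟨ ⊗≅ ≅-refl (∘H (⊗≅ ≅-refl (id≅ (sym (+-assoc b a b)))) ≅-refl) ⟩
        id 1 ⊗ ((σ 1 a ⊗ id ((b + a) + b)) ∘[ _ ] (id (1 + a) ⊗ (σ a b ⊗ id b)))
          ≅⟨ ⊗≅ ≅-refl disj1 ⟩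
        stage₁ ∎H
    rhs-perm : (id (suc a) ⊗ (σ (suc a) b ⊗ id b)) ∘[ _ ] ((id 1 ⊗ (σ 1 a ⊗ id a)) ⊗ id (b + b)) ≅ stage₂ ∘[ _ ] stage₁
    rhs-perm = beginH
      (id (suc a) ⊗ (σ (suc a) b ⊗ id b)) ∘[ _ ] ((id 1 ⊗ (σ 1 a ⊗ id a)) ⊗ id (b + b))
        ≅⟨ ∘H (⊗≅ ≅-refl (⊗≅ (hexR≅ {1} {a} {b}) ≅-refl)) ≅-refl ⟩
      (id (suc a) ⊗ (((σ 1 b ⊗ id a) ∘[ sym (+-assoc 1 b a) ] (id 1 ⊗ σ a b)) ⊗ id b)) ∘[ _ ] ((id 1 ⊗ (σ 1 a ⊗ id a)) ⊗ id (b + b))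
        ≅⟨ ∘H (≅-trans (⊗≅ ≅-refl wR) wL) ≅-refl ⟩
      ((id (suc a) ⊗ ((σ 1 b ⊗ id a) ⊗ id b)) ∘[ _ ] (id (suc a) ⊗ ((id 1 ⊗ σ a b) ⊗ id b)))
         ∘[ _ ] ((id 1 ⊗ (σ 1 a ⊗ id a)) ⊗ id (b + b))
        ≅⟨ ∘[]-assoc ⟩
      (id (suc a) ⊗ ((σ 1 b ⊗ id a) ⊗ id b)) ∘[ _ ] ((id (suc a) ⊗ ((id 1 ⊗ σ a b) ⊗ id b)) ∘[ _ ] ((id 1 ⊗ (σ 1 a ⊗ id a)) ⊗ id (b + b)))
        ≅⟨ ∘H to-stage₂ to-stage₁ ⟩
      stage₂ ∘[ _ ] stage₁ ∎H
      where
      to-stage₂ : id (suc a) ⊗ ((σ 1 b ⊗ id a) ⊗ id b) ≅ stage₂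
      to-stage₂ = beginH
        id (suc a) ⊗ ((σ 1 b ⊗ id a) ⊗ id b) ≅⟨ ⊗≅ (idsplit {1} {a}) assoc⊗ ⟩
        (id 1 ⊗ id a) ⊗ (σ 1 b ⊗ (id a ⊗ id b)) ≅⟨ assoc⊗ ⟩
        stage₂ ∎H
      to-stage₁ : (id (suc a) ⊗ ((id 1 ⊗ σ a b) ⊗ id b)) ∘[ _ ] ((id 1 ⊗ (σ 1 a ⊗ id a)) ⊗ id (b + b)) ≅ stage₁
      to-stage₁ = beginH
        (id (suc a) ⊗ ((id 1 ⊗ σ a b) ⊗ id b)) ∘[ _ ] ((id 1 ⊗ (σ 1 a ⊗ id a)) ⊗ id (b + b))
          ≅⟨ ∘H (≅-trans (⊗≅ (idsplit {1} {a}) assoc⊗) assoc⊗)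
                (≅-trans assoc⊗ (⊗≅ ≅-refl (≅-trans assoc⊗ (⊗≅ ≅-refl (⊗≅ ≅-refl (idsplit {b} {b})))))) ⟩
        (id 1 ⊗ (id a ⊗ (id 1 ⊗ (σ a b ⊗ id b)))) ∘[ _ ] (id 1 ⊗ (σ 1 a ⊗ (id a ⊗ (id b ⊗ id b))))
          ≅⟨ wL⁻ ⟩
        id 1 ⊗ ((id a ⊗ (id 1 ⊗ (σ a b ⊗ id b))) ∘[ _ ] (σ 1 a ⊗ (id a ⊗ (id b ⊗ id b))))
          ≅⟨ ⊗≅ ≅-refl (∘H (≅-trans (≅-sym assoc⊗) (⊗≅ idid≅ ≅-refl)) (⊗≅ ≅-refl id3)) ⟩
        id 1 ⊗ ((id (a + 1) ⊗ (σ a b ⊗ id b)) ∘[ _ ] (σ 1 a ⊗ id (a + (b + b))))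
          ≅⟨ ⊗≅ ≅-refl (∘H ≅-refl (⊗≅ ≅-refl (id≅ (trans (sym (+-assoc a b b)) refl)))) ⟩
        id 1 ⊗ ((id (a + 1) ⊗ (σ a b ⊗ id b)) ∘[ _ ] (σ 1 a ⊗ id ((a + b) + b)))
          ≅⟨ ⊗≅ ≅-refl disj2 ⟩
        stage₁ ∎H
    lhs-normal : D (suc (a + b)) ≅ normal-form
    lhs-normal = beginH
      D (suc (a + b)) ≅⟨ dⁿ-unfold ⟩
      (id 1 ⊗ (σ 1 (a + b) ⊗ id (a + b))) ∘ (d c ⊗ D (a + b)) ≅⟨ toH ⟩
      (id 1 ⊗ (σ 1 (a + b) ⊗ id (a + b))) ∘[ _ ] (d c ⊗ D (a + b))
         ≅⟨ ∘H ≅-refl (⊗≅ ≅-refl (dⁿ-split a b)) ⟩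
      (id 1 ⊗ (σ 1 (a + b) ⊗ id (a + b))) ∘[ _ ] (d c ⊗ ((id a ⊗ (σ a b ⊗ id b)) ∘[ split-shape a b ] (D a ⊗ D b)))
         ≅⟨ ∘H ≅-refl (tensL ) ⟩
      (id 1 ⊗ (σ 1 (a + b) ⊗ id (a + b))) ∘[ _ ] ((id 2 ⊗ (id a ⊗ (σ a b ⊗ id b))) ∘[ _ ] (d c ⊗ (D a ⊗ D b)))
         ≅˘⟨ ∘[]-assoc ⟩
      ((id 1 ⊗ (σ 1 (a + b) ⊗ id (a + b))) ∘[ _ ] (id 2 ⊗ (id a ⊗ (σ a b ⊗ id b)))) ∘[ _ ] (d c ⊗ (D a ⊗ D b))
         ≅⟨ ∘H lhs-perm ≅-refl ⟩
      normal-form ∎H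
    rhs-normal : (id (suc a) ⊗ (σ (suc a) b ⊗ id b)) ∘[ split-shape (suc a) b ] (D (suc a) ⊗ D b) ≅ normal-form
    rhs-normal = beginH
      (id (suc a) ⊗ (σ (suc a) b ⊗ id b)) ∘[ split-shape (suc a) b ] (D (suc a) ⊗ D b)
         ≅⟨ ∘H ≅-refl (⊗≅ (≅-trans dⁿ-unfold toH) ≅-refl) ⟩
      (id (suc a) ⊗ (σ (suc a) b ⊗ id b)) ∘[ _ ] (((id 1 ⊗ (σ 1 a ⊗ id a)) ∘[ _ ] (d c ⊗ D a)) ⊗ D b)
         ≅⟨ ∘H ≅-refl tensR ⟩
      (id (suc a) ⊗ (σ (suc a) b ⊗ id b)) ∘[ _ ] (((id 1 ⊗ (σ 1 a ⊗ id a)) ⊗ id (b + b)) ∘[ _ ] ((d c ⊗ D a) ⊗ D b))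
         ≅˘⟨ ∘[]-assoc ⟩
      ((id (suc a) ⊗ (σ (suc a) b ⊗ id b)) ∘[ _ ] ((id 1 ⊗ (σ 1 a ⊗ id a)) ⊗ id (b + b))) ∘[ _ ] ((d c ⊗ D a) ⊗ D b)
         ≅⟨ ∘H rhs-perm assoc⊗ ⟩
      normal-form ∎H

  E : (n : ℕ) → Tm (n + n) 0
  E = eⁿ c

  cross-state : ∀ {n} {X : Tm 0 2} → (σ n 1 ⊗ id 1) ∘[ sym (+-assoc n 1 1) ] (id n ⊗ X) ≅ (id 1 ⊗ σ 1 n) ∘[ refl ] (X ⊗ id n)
  cross-state {n} {X} = beginH
    (σ n 1 ⊗ id 1) ∘[ _ ] (id n ⊗ X)
      ≅˘⟨ ∘[]-idl ⟩
    id (1 + (n + 1)) ∘[ refl ] ((σ n 1 ⊗ id 1) ∘[ _ ] (id n ⊗ X))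
      ≅˘⟨ ∘H (≅-trans (≅-trans (wL⁻ {p = refl}) (⊗≅ ≅-refl (≅-trans (≅-sym toH) (≈⇒≅ (σ-inv n 1))))) idid≅) ≅-refl ⟩
    ((id 1 ⊗ σ 1 n) ∘[ refl ] (id 1 ⊗ σ n 1)) ∘[ refl ] ((σ n 1 ⊗ id 1) ∘[ _ ] (id n ⊗ X))
      ≅⟨ ∘[]-assoc ⟩
    (id 1 ⊗ σ 1 n) ∘[ refl ] ((id 1 ⊗ σ n 1) ∘[ refl ] ((σ n 1 ⊗ id 1) ∘[ _ ] (id n ⊗ X)))
      ≅˘⟨ ∘H ≅-refl ∘[]-assoc ⟩
    (id 1 ⊗ σ 1 n) ∘[ refl ] (((id 1 ⊗ σ n 1) ∘[ refl ] (σ n 1 ⊗ id 1)) ∘[ _ ] (id n ⊗ X))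
      ≅˘⟨ ∘H ≅-refl (∘H hexL≅ ≅-refl) ⟩
    (id 1 ⊗ σ 1 n) ∘[ refl ] (σ n 2 ∘[ refl ] (id n ⊗ X))
      ≅⟨ ∘H ≅-refl natσH ⟩
    (id 1 ⊗ σ 1 n) ∘[ refl ] ((X ⊗ id n) ∘[ refl ] σ n 0)
      ≅⟨ ∘H ≅-refl (≅-trans (∘H ≅-refl σn0≅) ∘[]-idr) ⟩
    (id 1 ⊗ σ 1 n) ∘[ refl ] (X ⊗ id n) ∎H

  eⁿ-unfold : ∀ {n} → E (suc n) ≅ (d c † ⊗ E n) ∘[ refl ] (id 1 ⊗ (σ n 1 ⊗ id n))
  eⁿ-unfold {n} = beginH
    E (suc n) ≅⟨ †≅ dⁿ-unfold ⟩
    ((id 1 ⊗ (σ 1 n ⊗ id n)) ∘ (d c ⊗ D n)) † ≅⟨ ≈⇒≅ dag∘ ⟩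
    (d c ⊗ D n) † ∘ (id 1 ⊗ (σ 1 n ⊗ id n)) † ≅⟨ ≈⇒≅ (dag⊗ ⟩∘⟨ (≈-trans dag⊗ (dagid ⟩⊗⟨ ≈-trans dag⊗ (σ† ⟩⊗⟨ dagid)))) ⟩
    (d c † ⊗ E n) ∘ (id 1 ⊗ (σ n 1 ⊗ id n)) ≅⟨ toH ⟩
    (d c † ⊗ E n) ∘[ refl ] (id 1 ⊗ (σ n 1 ⊗ id n)) ∎H

  -- In the
  -- step, the outermost cup and cap are separated from the rest and cancelled by
  -- the single-wire snake, leaving the snake for k wires.
  snakeⁿ : ∀ k → (E k ⊗ id k) ∘[ sym (+-assoc k k k) ] (id k ⊗ D k) ≅ id k
  snakeⁿ zero = beginH
    (id 0 † ⊗ id 0) ∘[ _ ] (id 0 ⊗ id 0) ≅⟨ ∘H (⊗≅ (≈⇒≅ dagid) ≅-refl) ≅-refl ⟩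
    (id 0 ⊗ id 0) ∘[ _ ] (id 0 ⊗ id 0) ≅⟨ ∘H idid≅ ≅-refl ⟩
    id 0 ∘[ _ ] (id 0 ⊗ id 0) ≅⟨ ∘[]-idl ⟩
    id 0 ⊗ id 0 ≅⟨ idid≅ ⟩
    id 0 ∎H
  snakeⁿ (suc n) = beginH
    (E (suc n) ⊗ id (suc n)) ∘[ _ ] (id (suc n) ⊗ D (suc n))
      ≅⟨ ∘H (⊗≅ eⁿ-unfold ≅-refl) (⊗≅ ≅-refl (≅-trans dⁿ-unfold toH)) ⟩
    (((e ⊗ E n) ∘[ refl ] cap-cross) ⊗ id (suc n)) ∘[ _ ] (id (suc n) ⊗ (cup-cross ∘[ refl ] (d c ⊗ D n)))
      ≅⟨ ∘H wR wL ⟩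
    (((e ⊗ E n) ⊗ id (suc n)) ∘[ _ ] (cap-cross ⊗ id (suc n))) ∘[ _ ] ((id (suc n) ⊗ cup-cross) ∘[ _ ] (id (suc n) ⊗ (d c ⊗ D n)))
      ≅⟨ ∘[]-assoc ⟩
    ((e ⊗ E n) ⊗ id (suc n)) ∘[ _ ] ((cap-cross ⊗ id (suc n)) ∘[ _ ] ((id (suc n) ⊗ cup-cross) ∘[ _ ] (id (suc n) ⊗ (d c ⊗ D n))))
      ≅⟨ ∘H ≅-refl (≅-sym ∘[]-assoc) ⟩
    ((e ⊗ E n) ⊗ id (suc n)) ∘[ _ ] (((cap-cross ⊗ id (suc n)) ∘[ _ ] (id (suc n) ⊗ cup-cross)) ∘[ _ ] (id (suc n) ⊗ (d c ⊗ D n)))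
      ≅⟨ ∘H ≅-refl (∘H crossings-commute ≅-refl) ⟩
    ((e ⊗ E n) ⊗ id (suc n)) ∘[ _ ] ((cross₂ ∘[ snake-shape n ] cross₁) ∘[ _ ] (id (suc n) ⊗ (d c ⊗ D n)))
      ≅⟨ ∘H ≅-refl ∘[]-assoc ⟩
    ((e ⊗ E n) ⊗ id (suc n)) ∘[ _ ] (cross₂ ∘[ _ ] (cross₁ ∘[ _ ] (id (suc n) ⊗ (d c ⊗ D n))))
      ≅⟨ ∘H ≅-refl (∘H ≅-refl slide-past-cup) ⟩
    ((e ⊗ E n) ⊗ id (suc n)) ∘[ _ ] (cross₂ ∘[ _ ] (id 1 ⊗ (((id 1 ⊗ σ 1 n) ⊗ id (n + n)) ∘[ _ ] ((d c ⊗ id n) ⊗ D n))))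
      ≅⟨ ∘H ≅-refl merge-crossings ⟩
    ((e ⊗ E n) ⊗ id (suc n)) ∘[ _ ] ((id 1 ⊗ (id 1 ⊗ (σ 1 (n + n) ⊗ id n))) ∘[ _ ] (id 1 ⊗ ((d c ⊗ id n) ⊗ D n)))
      ≅⟨ cancel-outer-snake ⟩
    (cap-rest ∘[ _ ] wire-cross) ∘[ _ ] (id 1 ⊗ (id n ⊗ D n))
      ≅⟨ ∘H slide-past-cap ≅-refl ⟩
    ((id 1 ⊗ E n) ⊗ id n) ∘[ _ ] (id 1 ⊗ (id n ⊗ D n))
      ≅⟨ ∘H assoc⊗ ≅-refl ⟩
    (id 1 ⊗ (E n ⊗ id n)) ∘[ _ ] (id 1 ⊗ (id n ⊗ D n))
      ≅⟨ wL⁻ ⟩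
    id 1 ⊗ ((E n ⊗ id n) ∘[ _ ] (id n ⊗ D n))
      ≅⟨ ⊗≅ ≅-refl (snakeⁿ n) ⟩
    id 1 ⊗ id n ≅⟨ idid≅ ⟩
    id (suc n) ∎H
    where
    e : Tm 2 0
    e = d c †
    cup-cross : Tm (1 + ((1 + n) + n)) (1 + ((n + 1) + n))
    cup-cross = id 1 ⊗ (σ 1 n ⊗ id n)
    cap-cross : Tm (1 + ((n + 1) + n)) (1 + ((1 + n) + n))
    cap-cross = id 1 ⊗ (σ n 1 ⊗ id n)
    cross₁ : Tm (1 + ((n + 1) + (1 + (n + n)))) (1 + ((1 + n) + (1 + (n + n))))
    cross₁ = id 1 ⊗ (σ n 1 ⊗ (id 1 ⊗ (id n ⊗ id n)))
    cross₂ : Tm (1 + (1 + (n + ((1 + n) + n)))) (1 + (1 + (n + ((n + 1) + n))))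
    cross₂ = id 1 ⊗ (id 1 ⊗ (id n ⊗ (σ 1 n ⊗ id n)))
    cross₁₂ : Tm (1 + ((n + 1) + ((1 + n) + n))) (1 + ((1 + n) + ((n + 1) + n)))
    cross₁₂ = id 1 ⊗ (σ n 1 ⊗ (σ 1 n ⊗ id n))
    cap-rest : Tm ((n + n) + suc n) (suc n)
    cap-rest = E n ⊗ id (suc n)
    wire-cross : Tm ((1 + (n + n)) + n) (((n + n) + 1) + n)
    wire-cross = σ 1 (n + n) ⊗ id n
    crossings-commute : (cap-cross ⊗ id (suc n)) ∘[ _ ] (id (suc n) ⊗ cup-cross) ≅ cross₂ ∘[ snake-shape n ] cross₁
    crossings-commute = ≅-trans crossings-merge (≅-sym crossings-split)
      where
      crossings-merge : (cap-cross ⊗ id (suc n)) ∘[ _ ] (id (suc n) ⊗ cup-cross) ≅ cross₁₂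
      crossings-merge = beginH
        (cap-cross ⊗ id (suc n)) ∘[ _ ] (id (suc n) ⊗ cup-cross)
          ≅⟨ ∘H (≅-trans assoc⊗ (⊗≅ ≅-refl assoc⊗)) (≅-trans (⊗≅ (idsplit {1} {n}) ≅-refl) assoc⊗) ⟩
        (id 1 ⊗ (σ n 1 ⊗ (id n ⊗ id (suc n)))) ∘[ _ ] (id 1 ⊗ (id n ⊗ cup-cross))
          ≅⟨ wL⁻ ⟩
        id 1 ⊗ ((σ n 1 ⊗ (id n ⊗ id (suc n))) ∘[ _ ] (id n ⊗ (id 1 ⊗ (σ 1 n ⊗ id n))))
          ≅⟨ ⊗≅ ≅-refl (∘H (⊗≅ ≅-refl (≅-trans idid≅ (id≅ (sym (+-assoc n 1 n)))))
                           (≅-trans (≅-sym assoc⊗) (⊗≅ idid≅ ≅-refl))) ⟩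
        id 1 ⊗ ((σ n 1 ⊗ id ((n + 1) + n)) ∘[ _ ] (id (n + 1) ⊗ (σ 1 n ⊗ id n)))
          ≅⟨ ⊗≅ ≅-refl disj1 ⟩
        cross₁₂ ∎H
      crossings-split : cross₂ ∘[ snake-shape n ] cross₁ ≅ cross₁₂
      crossings-split = beginH
        cross₂ ∘[ snake-shape n ] cross₁ ≅⟨ wL⁻ ⟩
        id 1 ⊗ ((id 1 ⊗ (id n ⊗ (σ 1 n ⊗ id n))) ∘[ _ ] (σ n 1 ⊗ (id 1 ⊗ (id n ⊗ id n))))
          ≅⟨ ⊗≅ ≅-refl (∘H (≅-trans (≅-sym assoc⊗) (⊗≅ idid≅ ≅-refl))
                           (⊗≅ ≅-refl (≅-trans id3 (id≅ (sym (+-assoc 1 n n)))))) ⟩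
        id 1 ⊗ ((id (1 + n) ⊗ (σ 1 n ⊗ id n)) ∘[ _ ] (σ n 1 ⊗ id ((1 + n) + n)))
          ≅⟨ ⊗≅ ≅-refl disj2 ⟩
        cross₁₂ ∎H
    slide-past-cup : cross₁ ∘[ _ ] (id (suc n) ⊗ (d c ⊗ D n)) ≅ id 1 ⊗ (((id 1 ⊗ σ 1 n) ⊗ id (n + n)) ∘[ _ ] ((d c ⊗ id n) ⊗ D n))
    slide-past-cup = beginH
      cross₁ ∘[ _ ] (id (suc n) ⊗ (d c ⊗ D n))
        ≅⟨ ∘H ≅-refl (≅-trans (⊗≅ (idsplit {1} {n}) ≅-refl) assoc⊗) ⟩
      cross₁ ∘[ _ ] (id 1 ⊗ (id n ⊗ (d c ⊗ D n)))
        ≅⟨ wL⁻ ⟩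
      id 1 ⊗ ((σ n 1 ⊗ (id 1 ⊗ (id n ⊗ id n))) ∘[ _ ] (id n ⊗ (d c ⊗ D n)))
        ≅⟨ ⊗≅ ≅-refl (∘H (≅-trans (⊗≅ ≅-refl (⊗≅ ≅-refl (idid≅ {n} {n}))) (≅-sym assoc⊗)) (≅-sym assoc⊗)) ⟩
      id 1 ⊗ (((σ n 1 ⊗ id 1) ⊗ id (n + n)) ∘[ _ ] ((id n ⊗ d c) ⊗ D n))
        ≅⟨ ⊗≅ ≅-refl ichR⁻ ⟩
      id 1 ⊗ (((σ n 1 ⊗ id 1) ∘[ _ ] (id n ⊗ d c)) ⊗ D n)
        ≅⟨ ⊗≅ ≅-refl (⊗≅ cross-state ≅-refl) ⟩
      id 1 ⊗ (((id 1 ⊗ σ 1 n) ∘[ refl ] (d c ⊗ id n)) ⊗ D n)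
        ≅⟨ ⊗≅ ≅-refl tensR ⟩
      id 1 ⊗ (((id 1 ⊗ σ 1 n) ⊗ id (n + n)) ∘[ _ ] ((d c ⊗ id n) ⊗ D n)) ∎H
    merge-crossings : cross₂ ∘[ _ ] (id 1 ⊗ (((id 1 ⊗ σ 1 n) ⊗ id (n + n)) ∘[ _ ] ((d c ⊗ id n) ⊗ D n)))
            ≅ (id 1 ⊗ (id 1 ⊗ (σ 1 (n + n) ⊗ id n))) ∘[ _ ] (id 1 ⊗ ((d c ⊗ id n) ⊗ D n))
    merge-crossings = beginH
      cross₂ ∘[ _ ] (id 1 ⊗ (((id 1 ⊗ σ 1 n) ⊗ id (n + n)) ∘[ _ ] ((d c ⊗ id n) ⊗ D n)))
        ≅⟨ ∘H ≅-refl wL ⟩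
      cross₂ ∘[ _ ] ((id 1 ⊗ ((id 1 ⊗ σ 1 n) ⊗ id (n + n))) ∘[ _ ] (id 1 ⊗ ((d c ⊗ id n) ⊗ D n)))
        ≅˘⟨ ∘[]-assoc ⟩
      (cross₂ ∘[ _ ] (id 1 ⊗ ((id 1 ⊗ σ 1 n) ⊗ id (n + n)))) ∘[ _ ] (id 1 ⊗ ((d c ⊗ id n) ⊗ D n))
        ≅⟨ ∘H perm ≅-refl ⟩
      (id 1 ⊗ (id 1 ⊗ (σ 1 (n + n) ⊗ id n))) ∘[ _ ] (id 1 ⊗ ((d c ⊗ id n) ⊗ D n)) ∎H
      where
      perm : cross₂ ∘[ _ ] (id 1 ⊗ ((id 1 ⊗ σ 1 n) ⊗ id (n + n))) ≅ id 1 ⊗ (id 1 ⊗ (σ 1 (n + n) ⊗ id n))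
      perm = beginH
        cross₂ ∘[ _ ] (id 1 ⊗ ((id 1 ⊗ σ 1 n) ⊗ id (n + n)))
          ≅⟨ wL⁻ ⟩
        id 1 ⊗ ((id 1 ⊗ (id n ⊗ (σ 1 n ⊗ id n))) ∘[ _ ] ((id 1 ⊗ σ 1 n) ⊗ id (n + n)))
          ≅⟨ ⊗≅ ≅-refl (∘H ≅-refl assoc⊗) ⟩
        id 1 ⊗ ((id 1 ⊗ (id n ⊗ (σ 1 n ⊗ id n))) ∘[ _ ] (id 1 ⊗ (σ 1 n ⊗ id (n + n))))
          ≅⟨ ⊗≅ ≅-refl wL⁻ ⟩
        id 1 ⊗ (id 1 ⊗ ((id n ⊗ (σ 1 n ⊗ id n)) ∘[ _ ] (σ 1 n ⊗ id (n + n))))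
          ≅⟨ ⊗≅ ≅-refl (⊗≅ ≅-refl (∘H (≅-sym assoc⊗) (≅-trans (⊗≅ ≅-refl (idsplit {n} {n})) (≅-sym assoc⊗)))) ⟩
        id 1 ⊗ (id 1 ⊗ (((id n ⊗ σ 1 n) ⊗ id n) ∘[ _ ] ((σ 1 n ⊗ id n) ⊗ id n)))
          ≅⟨ ⊗≅ ≅-refl (⊗≅ ≅-refl wR⁻) ⟩
        id 1 ⊗ (id 1 ⊗ (((id n ⊗ σ 1 n) ∘[ _ ] (σ 1 n ⊗ id n)) ⊗ id n))
          ≅˘⟨ ⊗≅ ≅-refl (⊗≅ ≅-refl (⊗≅ hexL≅ ≅-refl)) ⟩
        id 1 ⊗ (id 1 ⊗ (σ 1 (n + n) ⊗ id n)) ∎H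
    cancel-outer-snake : ((e ⊗ E n) ⊗ id (suc n)) ∘[ _ ] ((id 1 ⊗ (id 1 ⊗ wire-cross)) ∘[ _ ] (id 1 ⊗ ((d c ⊗ id n) ⊗ D n)))
            ≅ (cap-rest ∘[ _ ] wire-cross) ∘[ _ ] (id 1 ⊗ (id n ⊗ D n))
    cancel-outer-snake = beginH
      ((e ⊗ E n) ⊗ id (suc n)) ∘[ _ ] ((id 1 ⊗ (id 1 ⊗ wire-cross)) ∘[ _ ] (id 1 ⊗ ((d c ⊗ id n) ⊗ D n)))
        ≅˘⟨ ∘[]-assoc ⟩
      (((e ⊗ E n) ⊗ id (suc n)) ∘[ _ ] (id 1 ⊗ (id 1 ⊗ wire-cross))) ∘[ _ ] (id 1 ⊗ ((d c ⊗ id n) ⊗ D n))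
        ≅⟨ ∘H (∘H assoc⊗ (≅-trans (≅-sym assoc⊗) (⊗≅ idid≅ ≅-refl))) ≅-refl ⟩
      ((e ⊗ cap-rest) ∘[ _ ] (id 2 ⊗ wire-cross)) ∘[ _ ] (id 1 ⊗ ((d c ⊗ id n) ⊗ D n))
        ≅⟨ ∘H fL ≅-refl ⟩
      (e ⊗ (cap-rest ∘[ _ ] wire-cross)) ∘[ _ ] (id 1 ⊗ ((d c ⊗ id n) ⊗ D n))
        ≅⟨ ∘H (≈⇒≅ splitR) ≅-refl ⟩
      ((id 0 ⊗ (cap-rest ∘[ _ ] wire-cross)) ∘ (e ⊗ id ((1 + (n + n)) + n))) ∘[ _ ] (id 1 ⊗ ((d c ⊗ id n) ⊗ D n))
        ≅⟨ ∘H toH ≅-refl ⟩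
      ((id 0 ⊗ (cap-rest ∘[ _ ] wire-cross)) ∘[ refl ] (e ⊗ id ((1 + (n + n)) + n))) ∘[ _ ] (id 1 ⊗ ((d c ⊗ id n) ⊗ D n))
        ≅⟨ ∘[]-assoc ⟩
      (id 0 ⊗ (cap-rest ∘[ _ ] wire-cross)) ∘[ refl ] ((e ⊗ id ((1 + (n + n)) + n)) ∘[ _ ] (id 1 ⊗ ((d c ⊗ id n) ⊗ D n)))
        ≅⟨ ∘H unitL≅ (∘H (≅-trans (⊗≅ ≅-refl (id≅ (cong suc (+-assoc n n n)))) (≅-trans (⊗≅ ≅-refl (idsplit {1} {n + (n + n)})) (≅-sym assoc⊗)))
                         (≅-trans (⊗≅ ≅-refl assoc⊗) (≅-sym assoc⊗))) ⟩
      (cap-rest ∘[ _ ] wire-cross) ∘[ _ ] (((e ⊗ id 1) ⊗ id (n + (n + n))) ∘[ _ ] ((id 1 ⊗ d c) ⊗ (id n ⊗ D n)))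
        ≅⟨ ∘H ≅-refl ichR⁻ ⟩
      (cap-rest ∘[ _ ] wire-cross) ∘[ _ ] (((e ⊗ id 1) ∘[ _ ] (id 1 ⊗ d c)) ⊗ (id n ⊗ D n))
        ≅⟨ ∘H ≅-refl (⊗≅ (≅-trans (≅-sym toH) (≈⇒≅ (≈-trans ((d†≈cap ⟩⊗⟨ rfl) ⟩∘⟨ rfl) snake₁))) ≅-refl) ⟩
      (cap-rest ∘[ _ ] wire-cross) ∘[ _ ] (id 1 ⊗ (id n ⊗ D n)) ∎H
    slide-past-cap : cap-rest ∘[ _ ] wire-cross ≅ (id 1 ⊗ E n) ⊗ id n
    slide-past-cap = beginH
      cap-rest ∘[ _ ] wire-cross ≅⟨ ∘H (≅-trans (⊗≅ ≅-refl (idsplit {1} {n})) (≅-sym assoc⊗)) ≅-refl ⟩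
      ((E n ⊗ id 1) ⊗ id n) ∘[ _ ] (σ 1 (n + n) ⊗ id n) ≅⟨ wR⁻ ⟩
      ((E n ⊗ id 1) ∘[ _ ] σ 1 (n + n)) ⊗ id n ≅˘⟨ ⊗≅ natσH ≅-refl ⟩
      (σ 1 0 ∘[ refl ] (id 1 ⊗ E n)) ⊗ id n ≅⟨ ⊗≅ (≅-trans (∘H σn0≅ ≅-refl) ∘[]-idl) ≅-refl ⟩
      (id 1 ⊗ E n) ⊗ id n ∎H

shuffle-shape : ∀ a b c d → (a + b) + (c + d) ≡ a + ((b + c) + d)
shuffle-shape = solve-∀

unshuffle-shape : ∀ a b → a + ((b + a) + b) ≡ (a + b) + (a + b)
unshuffle-shape = solve-∀

pair-past-exchange : ∀ {n m n' m'} {f : Tm n m} {h : Tm n' m'} →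
  ((f ⊗ h) ⊗ id (n + n')) ∘[ unshuffle-shape n n' ] (id n ⊗ (σ n n' ⊗ id n'))
  ≅ (id m ⊗ (σ n m' ⊗ id n')) ∘[ shuffle-shape m n m' n' ] ((f ⊗ id n) ⊗ (h ⊗ id n'))
pair-past-exchange {n} {m} {n'} {m'} {f} {h} = ≅-trans lhs≅middle (≅-sym rhs≅middle)
  where
  middle : Tm (n + ((n + n') + n')) (m + ((m' + n) + n'))
  middle = f ⊗ (((h ⊗ id n) ∘[ refl ] σ n n') ⊗ id n')
  lhs≅middle : ((f ⊗ h) ⊗ id (n + n')) ∘[ _ ] (id n ⊗ (σ n n' ⊗ id n')) ≅ middle
  lhs≅middle = beginH
    ((f ⊗ h) ⊗ id (n + n')) ∘[ _ ] (id n ⊗ (σ n n' ⊗ id n'))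
      ≅⟨ ∘H assoc⊗ ≅-refl ⟩
    (f ⊗ (h ⊗ id (n + n'))) ∘[ _ ] (id n ⊗ (σ n n' ⊗ id n'))
      ≅⟨ fL ⟩
    f ⊗ ((h ⊗ id (n + n')) ∘[ _ ] (σ n n' ⊗ id n'))
      ≅⟨ ⊗≅ ≅-refl (∘H (≅-trans (⊗≅ ≅-refl (idsplit {n} {n'})) (≅-sym assoc⊗)) ≅-refl) ⟩
    f ⊗ (((h ⊗ id n) ⊗ id n') ∘[ _ ] (σ n n' ⊗ id n'))
      ≅⟨ ⊗≅ ≅-refl wR⁻ ⟩
    middle ∎H
  rhs≅middle : (id m ⊗ (σ n m' ⊗ id n')) ∘[ shuffle-shape m n m' n' ] ((f ⊗ id n) ⊗ (h ⊗ id n')) ≅ middle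
  rhs≅middle = beginH
    (id m ⊗ (σ n m' ⊗ id n')) ∘[ _ ] ((f ⊗ id n) ⊗ (h ⊗ id n'))
      ≅⟨ ∘H ≅-refl assoc⊗ ⟩
    (id m ⊗ (σ n m' ⊗ id n')) ∘[ _ ] (f ⊗ (id n ⊗ (h ⊗ id n')))
      ≅⟨ fR ⟩
    f ⊗ ((σ n m' ⊗ id n') ∘[ _ ] (id n ⊗ (h ⊗ id n')))
      ≅⟨ ⊗≅ ≅-refl (∘H ≅-refl (≅-sym assoc⊗)) ⟩
    f ⊗ ((σ n m' ⊗ id n') ∘[ _ ] ((id n ⊗ h) ⊗ id n'))
      ≅⟨ ⊗≅ ≅-refl wR⁻ ⟩
    f ⊗ ((σ n m' ∘[ _ ] (id n ⊗ h)) ⊗ id n')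
      ≅⟨ ⊗≅ ≅-refl (⊗≅ natσH ≅-refl) ⟩
    middle ∎H

pair-past-exchange' : ∀ {n m n' m'} {f' : Tm m n} {h' : Tm m' n'} →
  (id m ⊗ (σ n m' ⊗ id n')) ∘[ shuffle-shape m n m' n' ] ((id m ⊗ f') ⊗ (id m' ⊗ h'))
  ≅ (id (m + m') ⊗ (f' ⊗ h')) ∘[ unshuffle-shape m m' ] (id m ⊗ (σ m m' ⊗ id m'))
pair-past-exchange' {n} {m} {n'} {m'} {f'} {h'} = ≅-trans lhs≅middle (≅-sym rhs≅middle)
  where
  middle : Tm (m + ((m + m') + m')) (m + ((m' + n) + n'))
  middle = id m ⊗ (((id m' ⊗ f') ∘[ refl ] σ m m') ⊗ h')
  lhs≅middle : (id m ⊗ (σ n m' ⊗ id n')) ∘[ shuffle-shape m n m' n' ] ((id m ⊗ f') ⊗ (id m' ⊗ h')) ≅ middle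
  lhs≅middle = beginH
    (id m ⊗ (σ n m' ⊗ id n')) ∘[ _ ] ((id m ⊗ f') ⊗ (id m' ⊗ h'))
      ≅⟨ ∘H ≅-refl assoc⊗ ⟩
    (id m ⊗ (σ n m' ⊗ id n')) ∘[ _ ] (id m ⊗ (f' ⊗ (id m' ⊗ h')))
      ≅⟨ wL⁻ ⟩
    id m ⊗ ((σ n m' ⊗ id n') ∘[ _ ] (f' ⊗ (id m' ⊗ h')))
      ≅⟨ ⊗≅ ≅-refl (∘H ≅-refl (≅-sym assoc⊗)) ⟩
    id m ⊗ ((σ n m' ⊗ id n') ∘[ _ ] ((f' ⊗ id m') ⊗ h'))
      ≅⟨ ⊗≅ ≅-refl ichR⁻ ⟩
    id m ⊗ ((σ n m' ∘[ _ ] (f' ⊗ id m')) ⊗ h')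
      ≅⟨ ⊗≅ ≅-refl (⊗≅ natσH ≅-refl) ⟩
    middle ∎H
  rhs≅middle : (id (m + m') ⊗ (f' ⊗ h')) ∘[ unshuffle-shape m m' ] (id m ⊗ (σ m m' ⊗ id m')) ≅ middle
  rhs≅middle = beginH
    (id (m + m') ⊗ (f' ⊗ h')) ∘[ _ ] (id m ⊗ (σ m m' ⊗ id m'))
      ≅⟨ ∘H (≅-trans (⊗≅ (idsplit {m} {m'}) ≅-refl) assoc⊗) ≅-refl ⟩
    (id m ⊗ (id m' ⊗ (f' ⊗ h'))) ∘[ _ ] (id m ⊗ (σ m m' ⊗ id m'))
      ≅⟨ wL⁻ ⟩
    id m ⊗ ((id m' ⊗ (f' ⊗ h')) ∘[ _ ] (σ m m' ⊗ id m'))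
      ≅⟨ ⊗≅ ≅-refl (∘H (≅-sym assoc⊗) ≅-refl) ⟩
    id m ⊗ (((id m' ⊗ f') ⊗ h') ∘[ _ ] (σ m m' ⊗ id m'))
      ≅⟨ ⊗≅ ≅-refl ichRid⁻ ⟩
    middle ∎H

module Sliding (c : Col) where
  open Cups c

  -- f slides along the c-cups when f applied to the first legs of d^{(n)} equals f†
  -- applied to the second legs of d^{(m)}.  For such f the transpose is f†.
  Slides : ∀ {n m} → Tm n m → Set
  Slides {n} {m} f = (f ⊗ id n) ∘ D n ≈ (id m ⊗ f †) ∘ D m

  CupSymmetric : ℕ → Set
  CupSymmetric k = σ k k ∘ D k ≈ D k

  slides-resp-≈ : ∀ {n m} {f f' : Tm n m} → f ≈ f' → Slides f → Slides f'
  slides-resp-≈ e s = ≈-trans ((≈-sym e ⟩⊗⟨ rfl) ⟩∘⟨ rfl) (≈-trans s ((rfl ⟩⊗⟨ †-cong e) ⟩∘⟨ rfl))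

  slides-resp-≅ : ∀ {n m n' m'} {f : Tm n m} {f' : Tm n' m'} → f ≅ f' → Slides f → Slides f'
  slides-resp-≅ (hq refl refl e) s = slides-resp-≈ e s

  slides-id : ∀ {n} → Slides (id n)
  slides-id = (rfl ⟩⊗⟨ ≈-sym dagid) ⟩∘⟨ rfl

  slides-∘ : ∀ {n m k} {h : Tm m k} {f : Tm n m} → Slides h → Slides f → Slides (h ∘ f)
  slides-∘ {n} {m} {k} {h} {f} sh sf = begin
    ((h ∘ f) ⊗ id n) ∘ D n ≈⟨ whiskR ⟩∘⟨ rfl ⟩
    ((h ⊗ id n) ∘ (f ⊗ id n)) ∘ D n ≈⟨ assoc ⟩
    (h ⊗ id n) ∘ ((f ⊗ id n) ∘ D n) ≈⟨ rfl ⟩∘⟨ sf ⟩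
    (h ⊗ id n) ∘ ((id m ⊗ f †) ∘ D m) ≈⟨ assoc˘ ⟩
    ((h ⊗ id n) ∘ (id m ⊗ f †)) ∘ D m ≈⟨ slide ⟩∘⟨ rfl ⟩
    ((id k ⊗ f †) ∘ (h ⊗ id m)) ∘ D m ≈⟨ assoc ⟩
    (id k ⊗ f †) ∘ ((h ⊗ id m) ∘ D m) ≈⟨ rfl ⟩∘⟨ sh ⟩
    (id k ⊗ f †) ∘ ((id k ⊗ h †) ∘ D k) ≈⟨ assoc˘ ⟩
    ((id k ⊗ f †) ∘ (id k ⊗ h †)) ∘ D k ≈˘⟨ whiskL ⟩∘⟨ rfl ⟩
    (id k ⊗ (f † ∘ h †)) ∘ D k ≈˘⟨ (rfl ⟩⊗⟨ dag∘) ⟩∘⟨ rfl ⟩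
    (id k ⊗ (h ∘ f) †) ∘ D k ∎

  opaque
    unfolding _∘[_]_
    slides-∘[] : ∀ {n m1 m2 k} {h : Tm m2 k} {f : Tm n m1} .{p : m1 ≡ m2} → Slides h → Slides f → Slides (h ∘[ p ] f)
    slides-∘[] {p = p} sh sf = go (glue p) sh sf
      where
      go : ∀ {n m1 m2 k} {h : Tm m2 k} {f : Tm n m1} (e : m1 ≡ m2) → Slides h → Slides f → Slides (h ∘ cast refl e f)
      go refl sh sf = slides-∘ sh sf

  -- Uses dⁿ-split to present the cup on n + n' wires as the cups on n and on n'
  -- wires, slides f and h separately, and moves the exchange of the middle blocks.
  slides-⊗ : ∀ {n m n' m'} {f : Tm n m} {h : Tm n' m'} → Slides f → Slides h → Slides (f ⊗ h)
  slides-⊗ {n} {m} {n'} {m'} {f} {h} sf sh = ≅⇒≈ (beginH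
    ((f ⊗ h) ⊗ id (n + n')) ∘ D (n + n') ≅⟨ toH ⟩
    ((f ⊗ h) ⊗ id (n + n')) ∘[ refl ] D (n + n') ≅⟨ ∘H ≅-refl (dⁿ-split n n') ⟩
    ((f ⊗ h) ⊗ id (n + n')) ∘[ _ ] ((id n ⊗ (σ n n' ⊗ id n')) ∘[ _ ] (D n ⊗ D n'))
      ≅⟨ ≅-sym ∘[]-assoc ⟩
    (((f ⊗ h) ⊗ id (n + n')) ∘[ _ ] (id n ⊗ (σ n n' ⊗ id n'))) ∘[ _ ] (D n ⊗ D n')
      ≅⟨ ∘H pair-past-exchange ≅-refl ⟩
    ((id m ⊗ (σ n m' ⊗ id n')) ∘[ _ ] ((f ⊗ id n) ⊗ (h ⊗ id n'))) ∘[ refl ] (D n ⊗ D n')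
      ≅⟨ ∘[]-assoc ⟩
    (id m ⊗ (σ n m' ⊗ id n')) ∘[ _ ] (((f ⊗ id n) ⊗ (h ⊗ id n')) ∘[ refl ] (D n ⊗ D n'))
      ≅⟨ ∘H ≅-refl (≅-sym (ichH {p = refl} {refl})) ⟩
    (id m ⊗ (σ n m' ⊗ id n')) ∘[ _ ] (((f ⊗ id n) ∘[ refl ] D n) ⊗ ((h ⊗ id n') ∘[ refl ] D n'))
      ≅⟨ ∘H ≅-refl (⊗≅ (≅-trans (≅-sym toH) (≅-trans (≈⇒≅ sf) toH)) (≅-trans (≅-sym toH) (≅-trans (≈⇒≅ sh) toH))) ⟩
    (id m ⊗ (σ n m' ⊗ id n')) ∘[ _ ] (((id m ⊗ f †) ∘[ refl ] D m) ⊗ ((id m' ⊗ h †) ∘[ refl ] D m'))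
      ≅⟨ ∘H ≅-refl ichH ⟩
    (id m ⊗ (σ n m' ⊗ id n')) ∘[ _ ] (((id m ⊗ f †) ⊗ (id m' ⊗ h †)) ∘[ _ ] (D m ⊗ D m'))
      ≅⟨ ≅-sym ∘[]-assoc ⟩
    ((id m ⊗ (σ n m' ⊗ id n')) ∘[ _ ] ((id m ⊗ f †) ⊗ (id m' ⊗ h †))) ∘[ _ ] (D m ⊗ D m')
      ≅⟨ ∘H pair-past-exchange' ≅-refl ⟩
    ((id (m + m') ⊗ (f † ⊗ h †)) ∘[ _ ] (id m ⊗ (σ m m' ⊗ id m'))) ∘[ _ ] (D m ⊗ D m')
      ≅⟨ ∘[]-assoc ⟩
    (id (m + m') ⊗ (f † ⊗ h †)) ∘[ _ ] ((id m ⊗ (σ m m' ⊗ id m')) ∘[ _ ] (D m ⊗ D m'))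
      ≅⟨ ∘H (⊗≅ ≅-refl (≈⇒≅ (≈-sym dag⊗))) (≅-sym (dⁿ-split m m')) ⟩
    (id (m + m') ⊗ (f ⊗ h) †) ∘[ _ ] D (m + m')
      ≅⟨ ≅-sym toH ⟩
    (id (m + m') ⊗ (f ⊗ h) †) ∘ D (m + m') ∎H)

  slides-σ : Slides (σ 1 1) → ∀ n m → Slides (σ n m)
  slides-σ s11 zero m = slides-resp-≅ (≅-sym σ0≅) slides-id
  slides-σ s11 (suc n) m = slides-resp-≅ (≅-sym (hexR≅ {1} {n} {m})) (slides-∘[] (slides-⊗ (σ1 m) slides-id) (slides-⊗ slides-id (slides-σ s11 n m)))
    where
    σ1 : ∀ m → Slides (σ 1 m)
    σ1 zero = slides-resp-≅ (≅-sym σn0≅) slides-id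
    σ1 (suc m) = slides-resp-≅ (≅-sym (hexL≅ {1} {1} {m})) (slides-∘[] (slides-⊗ slides-id (σ1 m)) (slides-⊗ s11 slides-id))

  -- With symmetric cups, sliding f along the first legs gives f† along the first
  -- legs too: exchange the legs, slide, and exchange back.
  slides-† : ∀ {n m} {f : Tm n m} → CupSymmetric n → CupSymmetric m → Slides f → Slides (f †)
  slides-† {n} {m} {f} yn ym s = begin
    (f † ⊗ id m) ∘ D m ≈˘⟨ rfl ⟩∘⟨ ym ⟩
    (f † ⊗ id m) ∘ (σ m m ∘ D m) ≈⟨ assoc˘ ⟩
    ((f † ⊗ id m) ∘ σ m m) ∘ D m ≈˘⟨ natσ ⟩∘⟨ rfl ⟩
    (σ m n ∘ (id m ⊗ f †)) ∘ D m ≈⟨ assoc ⟩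
    σ m n ∘ ((id m ⊗ f †) ∘ D m) ≈˘⟨ rfl ⟩∘⟨ s ⟩
    σ m n ∘ ((f ⊗ id n) ∘ D n) ≈⟨ assoc˘ ⟩
    (σ m n ∘ (f ⊗ id n)) ∘ D n ≈⟨ natσ ⟩∘⟨ rfl ⟩
    ((id n ⊗ f) ∘ σ n n) ∘ D n ≈⟨ assoc ⟩
    (id n ⊗ f) ∘ (σ n n ∘ D n) ≈⟨ rfl ⟩∘⟨ yn ⟩
    (id n ⊗ f) ∘ D n ≈˘⟨ (rfl ⟩⊗⟨ ††) ⟩∘⟨ rfl ⟩
    (id n ⊗ f † †) ∘ D n ∎

  -- The transpose of a sliding morphism: slide f across the cup d^{(n)}, so that
  -- f† is applied after the cap and cup have met, and straighten them by snakeⁿ.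
  transpose-of-sliding : ∀ {n m} {f : Tm n m} → Slides f → transpose c f ≈ f †
  transpose-of-sliding {n} {m} {f} sf = ≅⇒≈ (beginH
    transpose c f ≅⟨ cast≅ ⟩
    (E m ⊗ id n) ∘ (cast refl (sym (+-assoc m m n)) (id m ⊗ (f ⊗ id n)) ∘ (id m ⊗ D n)) ≅⟨ toH ⟩
    (E m ⊗ id n) ∘[ refl ] (cast refl (sym (+-assoc m m n)) (id m ⊗ (f ⊗ id n)) ∘ (id m ⊗ D n))
      ≅⟨ ∘H ≅-refl (∘≅ cast≅ ≅-refl) ⟩
    (E m ⊗ id n) ∘[ _ ] ((id m ⊗ (f ⊗ id n)) ∘ (id m ⊗ D n))
      ≅⟨ ∘H ≅-refl (≈⇒≅ (≈-trans (≈-sym whiskL) (rfl ⟩⊗⟨ sf))) ⟩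
    (E m ⊗ id n) ∘[ _ ] (id m ⊗ ((id m ⊗ f †) ∘ D m))
      ≅⟨ ∘H ≅-refl (≅-trans (≈⇒≅ whiskL) toH) ⟩
    (E m ⊗ id n) ∘[ _ ] ((id m ⊗ (id m ⊗ f †)) ∘[ refl ] (id m ⊗ D m))
      ≅⟨ ∘H ≅-refl (∘H (≅-trans (≅-sym assoc⊗) (⊗≅ idid≅ ≅-refl)) ≅-refl) ⟩
    (E m ⊗ id n) ∘[ _ ] ((id (m + m) ⊗ f †) ∘[ _ ] (id m ⊗ D m))
      ≅⟨ ≅-sym ∘[]-assoc ⟩
    ((E m ⊗ id n) ∘[ _ ] (id (m + m) ⊗ f †)) ∘[ _ ] (id m ⊗ D m)
      ≅⟨ ∘H (≅-trans disj1 (≅-sym disj2)) ≅-refl ⟩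
    ((id 0 ⊗ f †) ∘[ refl ] (E m ⊗ id m)) ∘[ _ ] (id m ⊗ D m)
      ≅⟨ ∘[]-assoc ⟩
    (id 0 ⊗ f †) ∘[ refl ] ((E m ⊗ id m) ∘[ _ ] (id m ⊗ D m))
      ≅⟨ ∘H ≅-refl (snakeⁿ m) ⟩
    (id 0 ⊗ f †) ∘[ _ ] id m
      ≅⟨ ∘[]-idr ⟩
    id 0 ⊗ f † ≅⟨ unitL≅ ⟩
    f † ∎H)

  cup-sym₀ : CupSymmetric 0
  cup-sym₀ = ≈-trans (σ00 ⟩∘⟨ rfl) idl

  record GeneratorsSlide : Set where
    field
      μ-slides : ∀ c' → Slides (μ c')
      η-slides : ∀ c' → Slides (η c')
      σ-slides : Slides (σ 1 1)
      cup-sym₁ : CupSymmetric 1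
      cup-sym₂ : CupSymmetric 2

  -- Structural induction on terms; the dagger case needs the statement for f and f†.
  every-morphism-slides : GeneratorsSlide → ∀ {n m} (f : Tm n m) → Slides f
  every-morphism-slides G f = proj₁ (both f)
    where
    open GeneratorsSlide G
    both : ∀ {n m} (f : Tm n m) → Slides f × Slides (f †)
    both (id n) = slides-id , slides-resp-≈ (≈-sym dagid) slides-id
    both (h ∘ f) = slides-∘ (proj₁ (both h)) (proj₁ (both f))
                 , slides-resp-≈ (≈-sym dag∘) (slides-∘ (proj₂ (both f)) (proj₂ (both h)))
    both (f ⊗ h) = slides-⊗ (proj₁ (both f)) (proj₁ (both h))
                 , slides-resp-≈ (≈-sym dag⊗) (slides-⊗ (proj₂ (both f)) (proj₂ (both h)))
    both (σ n m) = slides-σ σ-slides n m , slides-resp-≈ (≈-sym σ†) (slides-σ σ-slides m n)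
    both (μ c') = μ-slides c' , slides-† cup-sym₂ cup-sym₁ (μ-slides c')
    both (η c') = η-slides c' , slides-† cup-sym₀ cup-sym₁ (η-slides c')
    both (f †) = proj₂ (both f) , slides-resp-≈ (≈-sym ††) (proj₁ (both f))

module SmallCups (c : Col) where
  open Frobenius c
  open Cups c
  open Sliding c

  dd : Tm 0 4
  dd = d c ⊗ d c

  d¹≈d : dⁿ c 1 ≈ d c
  d¹≈d = begin
    (id 1 ⊗ (σ 1 0 ⊗ id 0)) ∘ (d c ⊗ id 0) ≈⟨ (rfl ⟩⊗⟨ (σ10 ⟩⊗⟨ rfl)) ⟩∘⟨ ≅⇒≈ unitR≅ ⟩
    (id 1 ⊗ (id 1 ⊗ id 0)) ∘ d c ≈⟨ ≈-trans (rfl ⟩⊗⟨ idid) idid ⟩∘⟨ rfl ⟩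
    id 2 ∘ d c ≈⟨ idl ⟩
    d c ∎

  d²≈ : dⁿ c 2 ≈ s2 ∘ dd
  d²≈ = rfl ⟩∘⟨ (rfl ⟩⊗⟨ d¹≈d)

  cup-sym₁ : CupSymmetric 1
  cup-sym₁ = ≈-trans (rfl ⟩∘⟨ d¹≈d) (≈-trans cup-sym (≈-sym d¹≈d))

  dd-swap-legs : (σ 1 1 ⊗ σ 1 1) ∘ dd ≈ dd
  dd-swap-legs = ≈-trans ich˘ (cup-sym ⟩⊗⟨ cup-sym)

  dd-swap-cups : σ 2 2 ∘ dd ≈ dd
  dd-swap-cups = ≈-trans natσ (≈-trans (rfl ⟩∘⟨ σ00) idr)

  -- σ 2 2 decomposes into crossings of adjacent wires; after cancelling s2 ∘ s2 these
  -- reduce to crossing the legs of both cups.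
  cup-sym₂ : CupSymmetric 2
  cup-sym₂ = begin
    σ 2 2 ∘ dⁿ c 2 ≈⟨ σ22≈ ⟩∘⟨ d²≈ ⟩
    ((s2 ∘ s1) ∘ (s3 ∘ s2)) ∘ (s2 ∘ dd) ≈⟨ ≈-trans assoc (≈-trans assoc (rfl ⟩∘⟨ rfl ⟩∘⟨ ≈-trans assoc (rfl ⟩∘⟨ assoc˘))) ⟩
    s2 ∘ s1 ∘ s3 ∘ (s2 ∘ s2) ∘ dd ≈⟨ rfl ⟩∘⟨ rfl ⟩∘⟨ rfl ⟩∘⟨ (s2-invol ⟩∘⟨ rfl) ⟩
    s2 ∘ s1 ∘ s3 ∘ id 4 ∘ dd ≈⟨ rfl ⟩∘⟨ rfl ⟩∘⟨ rfl ⟩∘⟨ idl ⟩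
    s2 ∘ s1 ∘ s3 ∘ dd ≈⟨ rfl ⟩∘⟨ pullˡ (≈-sym splitL) ⟩
    s2 ∘ (σ 1 1 ⊗ σ 1 1) ∘ dd ≈⟨ rfl ⟩∘⟨ dd-swap-legs ⟩
    s2 ∘ dd ≈˘⟨ d²≈ ⟩
    dⁿ c 2 ∎

  -- The crossing σ 1 1 on the first legs of d^{(2)} equals σ 1 1 on the second legs:
  -- both amount to exchanging the two cups of dd.
  σ-slides : Slides (σ 1 1)
  σ-slides = begin
    s1 ∘ dⁿ c 2 ≈⟨ rfl ⟩∘⟨ d²≈ ⟩
    s1 ∘ s2 ∘ dd ≈˘⟨ rfl ⟩∘⟨ ≈-trans (pullˡ s3-invol) idl ⟩
    s1 ∘ s3 ∘ s3 ∘ s2 ∘ dd ≈⟨ assoc˘ ⟩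
    (s1 ∘ s3) ∘ s3 ∘ s2 ∘ dd ≈⟨ slide ⟩∘⟨ rfl ⟩
    (s3 ∘ s1) ∘ s3 ∘ s2 ∘ dd ≈⟨ assoc ⟩
    s3 ∘ s1 ∘ s3 ∘ s2 ∘ dd ≈˘⟨ rfl ⟩∘⟨ ≈-trans (pullˡ s2-invol) idl ⟩
    s3 ∘ s2 ∘ s2 ∘ s1 ∘ s3 ∘ s2 ∘ dd ≈˘⟨ rfl ⟩∘⟨ rfl ⟩∘⟨ ≈-trans (σ22≈ ⟩∘⟨ rfl) (≈-trans assoc (≈-trans assoc (rfl ⟩∘⟨ rfl ⟩∘⟨ assoc))) ⟩
    s3 ∘ s2 ∘ σ 2 2 ∘ dd ≈⟨ rfl ⟩∘⟨ rfl ⟩∘⟨ dd-swap-cups ⟩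
    s3 ∘ s2 ∘ dd ≈˘⟨ (rfl ⟩⊗⟨ σ†) ⟩∘⟨ d²≈ ⟩
    (id 2 ⊗ σ 1 1 †) ∘ dⁿ c 2 ∎

  cross-cup : (σ 1 1 ⊗ id 1) ∘ (id 1 ⊗ d c) ≈ (id 1 ⊗ σ 1 1) ∘ (d c ⊗ id 1)
  cross-cup = ≅⇒≈ (≅-trans toH (≅-trans (cross-state {1} {d c}) (≅-sym toH)))

  -- μ on the first legs of d^{(2)}: bend one input with a cup (μ-bend gives δ) and
  -- use coassociativity and cocommutativity to reach δ on the second leg of d.
  μ-slides : Slides (μ c)
  μ-slides = begin
    (μ c ⊗ id 2) ∘ dⁿ c 2 ≈⟨ rfl ⟩∘⟨ d²≈ ⟩
    (μ c ⊗ id 2) ∘ s2 ∘ dd ≈⟨ rfl ⟩∘⟨ rfl ⟩∘⟨ ≈-trans splitR (rfl ⟩∘⟨ ≅⇒≈ unitR≅) ⟩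
    (μ c ⊗ id 2) ∘ s2 ∘ (id 2 ⊗ d c) ∘ d c ≈⟨ rfl ⟩∘⟨ rfl ⟩∘⟨ (≈-trans (≈-sym idid ⟩⊗⟨ rfl) (≅⇒≈ assoc⊗) ⟩∘⟨ rfl) ⟩
    (μ c ⊗ id 2) ∘ s2 ∘ (id 1 ⊗ (id 1 ⊗ d c)) ∘ d c ≈⟨ rfl ⟩∘⟨ pullˡ (≈-sym whiskL) ⟩
    (μ c ⊗ id 2) ∘ (id 1 ⊗ ((σ 1 1 ⊗ id 1) ∘ (id 1 ⊗ d c))) ∘ d c ≈⟨ rfl ⟩∘⟨ ((rfl ⟩⊗⟨ cross-cup) ⟩∘⟨ rfl) ⟩
    (μ c ⊗ id 2) ∘ (id 1 ⊗ ((id 1 ⊗ σ 1 1) ∘ (d c ⊗ id 1))) ∘ d c ≈⟨ rfl ⟩∘⟨ (whiskL ⟩∘⟨ rfl) ⟩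
    (μ c ⊗ id 2) ∘ ((id 1 ⊗ (id 1 ⊗ σ 1 1)) ∘ (id 1 ⊗ (d c ⊗ id 1))) ∘ d c ≈⟨ rfl ⟩∘⟨ assoc ⟩
    (μ c ⊗ id 2) ∘ (id 1 ⊗ (id 1 ⊗ σ 1 1)) ∘ (id 1 ⊗ (d c ⊗ id 1)) ∘ d c ≈⟨ assoc˘ ⟩
    ((μ c ⊗ id 2) ∘ (id 1 ⊗ (id 1 ⊗ σ 1 1))) ∘ (id 1 ⊗ (d c ⊗ id 1)) ∘ d c ≈⟨ μ-commutes-crossing ⟩∘⟨ rfl ⟩
    ((id 1 ⊗ σ 1 1) ∘ (μ c ⊗ id 2)) ∘ (id 1 ⊗ (d c ⊗ id 1)) ∘ d c ≈⟨ assoc ⟩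
    (id 1 ⊗ σ 1 1) ∘ (μ c ⊗ id 2) ∘ (id 1 ⊗ (d c ⊗ id 1)) ∘ d c ≈⟨ rfl ⟩∘⟨ pullˡ μ-bends-cup ⟩
    (id 1 ⊗ σ 1 1) ∘ (δ c ⊗ id 1) ∘ d c ≈⟨ rfl ⟩∘⟨ pullˡ coassoc ⟩
    (id 1 ⊗ σ 1 1) ∘ ((id 1 ⊗ δ c) ∘ δ c) ∘ η c ≈⟨ rfl ⟩∘⟨ assoc ⟩
    (id 1 ⊗ σ 1 1) ∘ (id 1 ⊗ δ c) ∘ d c ≈⟨ pullˡ (≈-trans (≈-sym whiskL) (rfl ⟩⊗⟨ cocomm)) ⟩
    (id 1 ⊗ δ c) ∘ d c ≈˘⟨ rfl ⟩∘⟨ d¹≈d ⟩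
    (id 1 ⊗ μ c †) ∘ dⁿ c 1 ∎
    where
    μ-commutes-crossing : (μ c ⊗ id 2) ∘ (id 1 ⊗ (id 1 ⊗ σ 1 1)) ≈ (id 1 ⊗ σ 1 1) ∘ (μ c ⊗ id 2)
    μ-commutes-crossing = ≈-trans (rfl ⟩∘⟨ ≈-trans (≅⇒≈ (≅-sym assoc⊗)) (idid ⟩⊗⟨ rfl)) (slide)
    μ-bends-cup : (μ c ⊗ id 2) ∘ (id 1 ⊗ (d c ⊗ id 1)) ≈ δ c ⊗ id 1
    μ-bends-cup = begin
      (μ c ⊗ id 2) ∘ (id 1 ⊗ (d c ⊗ id 1)) ≈⟨ ≈-trans (rfl ⟩⊗⟨ ≈-sym idid) (≅⇒≈ (≅-sym assoc⊗)) ⟩∘⟨ ≅⇒≈ (≅-sym assoc⊗) ⟩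
      ((μ c ⊗ id 1) ⊗ id 1) ∘ ((id 1 ⊗ d c) ⊗ id 1) ≈˘⟨ whiskR ⟩
      ((μ c ⊗ id 1) ∘ (id 1 ⊗ d c)) ⊗ id 1 ≈⟨ μ-bend ⟩⊗⟨ rfl ⟩
      δ c ⊗ id 1 ∎

  -- η slides because (id ⊗ ε) ∘ d = η, by the counit law.
  η-slides : Slides (η c)
  η-slides = begin
    (η c ⊗ id 0) ∘ id 0 ≈⟨ idr ⟩
    η c ⊗ id 0 ≈⟨ ≅⇒≈ unitR≅ ⟩
    η c ≈˘⟨ idl ⟩
    id 1 ∘ η c ≈˘⟨ counitR ⟩∘⟨ rfl ⟩
    ((id 1 ⊗ ε c) ∘ δ c) ∘ η c ≈⟨ assoc ⟩
    (id 1 ⊗ ε c) ∘ d c ≈˘⟨ rfl ⟩∘⟨ d¹≈d ⟩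
    (id 1 ⊗ η c †) ∘ dⁿ c 1 ∎

record Interacting (A B : Col) : Set where
  field
    bialgebra   : δ A ∘ μ B ≈ (μ B ⊗ μ B) ∘ ((id 1 ⊗ σ 1 1) ⊗ id 1) ∘ (δ A ⊗ δ A)
    copy-unit   : δ A ∘ η B ≈ η B ⊗ η B
    delete-mult : ε A ∘ μ B ≈ ε A ⊗ ε A
    unit-rel    : η B ≈ (ε B ⊗ id 1) ∘ δ A ∘ η A
    counit-rel  : ε A ≈ ε B ∘ μ B ∘ (id 1 ⊗ η A)

-- A and B form a commutative Hopf algebra whose antipode is the "bent wire"
-- built from an A-cup and a B-cap.  What matters below is that the antipode
-- relates the two cups and is a homomorphism for the multiplication of B; the
-- latter is the usual argument that antipodes are anti-homomorphisms, via
-- uniqueness of inverses for the convolution product.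
module Hopf {A B : Col} (I : Interacting A B) where
  open Interacting I renaming (bialgebra to bi; copy-unit to cp; delete-mult to dl; unit-rel to u1; counit-rel to u2)
  module FA = Frobenius A
  module FB = Frobenius B

  Δ : Tm 1 2
  Δ = δ A
  ∇ : Tm 2 1
  ∇ = μ A
  e : Tm 1 0
  e = ε A
  i : Tm 0 1
  i = η A
  m : Tm 2 1
  m = μ B
  u : Tm 0 1
  u = η B
  ε' : Tm 1 0
  ε' = ε B

  counitB-via-A : ε' ≈ e ∘ ∇ ∘ (u ⊗ id 1)
  counitB-via-A = begin
    ε' ≈⟨ †-cong u1 ⟩
    ((ε' ⊗ id 1) ∘ Δ ∘ i) † ≈⟨ dag∘ ⟩
    (Δ ∘ i) † ∘ (ε' ⊗ id 1) † ≈⟨ dag∘ ⟩∘⟨ dag⊗ ⟩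
    (e ∘ Δ †) ∘ (ε' † ⊗ id 1 †) ≈⟨ (rfl ⟩∘⟨ ††) ⟩∘⟨ (†† ⟩⊗⟨ dagid) ⟩
    (e ∘ ∇) ∘ (u ⊗ id 1) ≈⟨ assoc ⟩
    e ∘ ∇ ∘ (u ⊗ id 1) ∎

  εB-copy : (ε' ⊗ id 1) ∘ Δ ≈ ∇ ∘ (u ⊗ id 1)
  εB-copy = begin
    (ε' ⊗ id 1) ∘ Δ ≈⟨ (counitB-via-A ⟩⊗⟨ rfl) ⟩∘⟨ rfl ⟩
    ((e ∘ ∇ ∘ (u ⊗ id 1)) ⊗ id 1) ∘ Δ ≈⟨ ≈-trans whiskR (rfl ⟩∘⟨ whiskR) ⟩∘⟨ rfl ⟩
    ((e ⊗ id 1) ∘ (∇ ⊗ id 1) ∘ ((u ⊗ id 1) ⊗ id 1)) ∘ Δ ≈⟨ ≈-trans assoc (rfl ⟩∘⟨ assoc) ⟩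
    (e ⊗ id 1) ∘ (∇ ⊗ id 1) ∘ ((u ⊗ id 1) ⊗ id 1) ∘ Δ ≈⟨ rfl ⟩∘⟨ rfl ⟩∘⟨ (≈-trans ((≈-trans (≅⇒≈ assoc⊗) (rfl ⟩⊗⟨ idid)) ⟩∘⟨ rfl) state-ich) ⟩
    (e ⊗ id 1) ∘ (∇ ⊗ id 1) ∘ (u ⊗ Δ) ≈⟨ rfl ⟩∘⟨ rfl ⟩∘⟨ splitR ⟩
    (e ⊗ id 1) ∘ (∇ ⊗ id 1) ∘ (id 1 ⊗ Δ) ∘ (u ⊗ id 1) ≈⟨ rfl ⟩∘⟨ pullˡ (frobˡ A) ⟩
    (e ⊗ id 1) ∘ (Δ ∘ ∇) ∘ (u ⊗ id 1) ≈⟨ rfl ⟩∘⟨ assoc ⟩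
    (e ⊗ id 1) ∘ Δ ∘ ∇ ∘ (u ⊗ id 1) ≈⟨ pullˡ FA.counitL ⟩
    id 1 ∘ ∇ ∘ (u ⊗ id 1) ≈⟨ idl ⟩
    ∇ ∘ (u ⊗ id 1) ∎

  μA-absorbs-ηB : ∇ ∘ (u ⊗ id 1) ≈ u ∘ ε'
  μA-absorbs-ηB = begin
    ∇ ∘ (u ⊗ id 1) ≈˘⟨ idl ⟩
    id 1 ∘ ∇ ∘ (u ⊗ id 1) ≈˘⟨ FA.counitR ⟩∘⟨ rfl ⟩
    ((id 1 ⊗ e) ∘ Δ) ∘ ∇ ∘ (u ⊗ id 1) ≈⟨ assoc ⟩
    (id 1 ⊗ e) ∘ Δ ∘ ∇ ∘ (u ⊗ id 1) ≈⟨ rfl ⟩∘⟨ pullˡ (frobʳ A) ⟩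
    (id 1 ⊗ e) ∘ ((id 1 ⊗ ∇) ∘ (Δ ⊗ id 1)) ∘ (u ⊗ id 1) ≈⟨ rfl ⟩∘⟨ assoc ⟩
    (id 1 ⊗ e) ∘ (id 1 ⊗ ∇) ∘ (Δ ⊗ id 1) ∘ (u ⊗ id 1) ≈⟨ rfl ⟩∘⟨ rfl ⟩∘⟨ ≈-trans (≈-sym whiskR) (cp ⟩⊗⟨ rfl) ⟩
    (id 1 ⊗ e) ∘ (id 1 ⊗ ∇) ∘ ((u ⊗ u) ⊗ id 1) ≈⟨ rfl ⟩∘⟨ rfl ⟩∘⟨ ≅⇒≈ assoc⊗ ⟩
    (id 1 ⊗ e) ∘ (id 1 ⊗ ∇) ∘ (u ⊗ (u ⊗ id 1)) ≈⟨ rfl ⟩∘⟨ fuseʳ' ⟩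
    (id 1 ⊗ e) ∘ (u ⊗ (∇ ∘ (u ⊗ id 1))) ≈⟨ fuseʳ' ⟩
    u ⊗ (e ∘ ∇ ∘ (u ⊗ id 1)) ≈˘⟨ rfl ⟩⊗⟨ counitB-via-A ⟩
    u ⊗ ε' ≈⟨ splitL ⟩
    (u ⊗ id 0) ∘ (id 0 ⊗ ε') ≈⟨ ≅⇒≈ unitR≅ ⟩∘⟨ ⊗-unitˡ _ ⟩
    u ∘ ε' ∎

  antipode : Tm 1 1
  antipode = (id 1 ⊗ cap B) ∘ (d A ⊗ id 1)

  -- Applying the antipode to one leg of the B-cup gives the A-cup (snake for B).
  cup-via-antipode : d A ≈ (antipode ⊗ id 1) ∘ d B
  cup-via-antipode = ≈-sym (begin
    (antipode ⊗ id 1) ∘ d B ≈⟨ whiskR ⟩∘⟨ rfl ⟩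
    (((id 1 ⊗ cap B) ⊗ id 1) ∘ ((d A ⊗ id 1) ⊗ id 1)) ∘ d B ≈⟨ assoc ⟩
    ((id 1 ⊗ cap B) ⊗ id 1) ∘ ((d A ⊗ id 1) ⊗ id 1) ∘ d B ≈⟨ rfl ⟩∘⟨ (≈-trans (≅⇒≈ assoc⊗) (rfl ⟩⊗⟨ idid) ⟩∘⟨ rfl) ⟩
    ((id 1 ⊗ cap B) ⊗ id 1) ∘ (d A ⊗ id 2) ∘ d B ≈⟨ rfl ⟩∘⟨ state-ich ⟩
    ((id 1 ⊗ cap B) ⊗ id 1) ∘ (d A ⊗ d B) ≈⟨ rfl ⟩∘⟨ splitR ⟩
    ((id 1 ⊗ cap B) ⊗ id 1) ∘ (id 2 ⊗ d B) ∘ (d A ⊗ id 0) ≈⟨ rfl ⟩∘⟨ rfl ⟩∘⟨ ≅⇒≈ unitR≅ ⟩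
    ((id 1 ⊗ cap B) ⊗ id 1) ∘ (id 2 ⊗ d B) ∘ d A ≈⟨ assoc˘ ⟩
    (((id 1 ⊗ cap B) ⊗ id 1) ∘ (id 2 ⊗ d B)) ∘ d A ≈⟨ (≅⇒≈ assoc⊗ ⟩∘⟨ ≈-trans (≈-sym idid ⟩⊗⟨ rfl) (≅⇒≈ assoc⊗)) ⟩∘⟨ rfl ⟩
    ((id 1 ⊗ (cap B ⊗ id 1)) ∘ (id 1 ⊗ (id 1 ⊗ d B))) ∘ d A ≈˘⟨ whiskL ⟩∘⟨ rfl ⟩
    (id 1 ⊗ ((cap B ⊗ id 1) ∘ (id 1 ⊗ d B))) ∘ d A ≈⟨ (rfl ⟩⊗⟨ FB.snake₁) ⟩∘⟨ rfl ⟩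
    (id 1 ⊗ id 1) ∘ d A ≈⟨ idid ⟩∘⟨ rfl ⟩
    id 2 ∘ d A ≈⟨ idl ⟩
    d A ∎)

  antipode-rewire : m ∘ ((id 1 ⊗ cap B) ⊗ id 1) ∘ (id 2 ⊗ σ 1 1) ≈ (id 1 ⊗ ε') ∘ (m ⊗ m) ∘ ((id 1 ⊗ σ 1 1) ⊗ id 1)
  antipode-rewire = begin
    m ∘ ((id 1 ⊗ cap B) ⊗ id 1) ∘ (id 2 ⊗ σ 1 1) ≈⟨ rfl ⟩∘⟨ (≈-trans (≅⇒≈ assoc⊗) (≈-trans (rfl ⟩⊗⟨ cap-past-crossings) (≈-trans whiskL (rfl ⟩∘⟨ whiskL)))) ⟩∘⟨ rfl ⟩
    m ∘ ((id 1 ⊗ (id 1 ⊗ cap B)) ∘ (id 1 ⊗ (σ 1 1 ⊗ id 1)) ∘ (id 1 ⊗ (id 1 ⊗ σ 1 1))) ∘ (id 2 ⊗ σ 1 1)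
      ≈⟨ rfl ⟩∘⟨ ≈-trans assoc (rfl ⟩∘⟨ assoc) ⟩
    m ∘ (id 1 ⊗ (id 1 ⊗ cap B)) ∘ (id 1 ⊗ (σ 1 1 ⊗ id 1)) ∘ (id 1 ⊗ (id 1 ⊗ σ 1 1)) ∘ (id 2 ⊗ σ 1 1)
      ≈⟨ rfl ⟩∘⟨ rfl ⟩∘⟨ rfl ⟩∘⟨ crossings-cancel ⟩
    m ∘ (id 1 ⊗ (id 1 ⊗ cap B)) ∘ (id 1 ⊗ (σ 1 1 ⊗ id 1)) ∘ id 4 ≈⟨ rfl ⟩∘⟨ rfl ⟩∘⟨ idr ⟩
    m ∘ (id 1 ⊗ (id 1 ⊗ cap B)) ∘ (id 1 ⊗ (σ 1 1 ⊗ id 1)) ≈⟨ assoc˘ ⟩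
    (m ∘ (id 1 ⊗ (id 1 ⊗ cap B))) ∘ (id 1 ⊗ (σ 1 1 ⊗ id 1)) ≈⟨ cap-after-m ⟩∘⟨ ≈-sym (≅⇒≈ assoc⊗) ⟩
    ((id 1 ⊗ ε') ∘ (m ⊗ m)) ∘ ((id 1 ⊗ σ 1 1) ⊗ id 1) ≈⟨ assoc ⟩
    (id 1 ⊗ ε') ∘ (m ⊗ m) ∘ ((id 1 ⊗ σ 1 1) ⊗ id 1) ∎
    where
    cap-past-crossings : cap B ⊗ id 1 ≈ (id 1 ⊗ cap B) ∘ (σ 1 1 ⊗ id 1) ∘ (id 1 ⊗ σ 1 1)
    cap-past-crossings = begin
      cap B ⊗ id 1 ≈˘⟨ idl ⟩
      id 1 ∘ (cap B ⊗ id 1) ≈˘⟨ σ01 ⟩∘⟨ rfl ⟩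
      σ 0 1 ∘ (cap B ⊗ id 1) ≈⟨ natσ ⟩
      (id 1 ⊗ cap B) ∘ σ 2 1 ≈⟨ rfl ⟩∘⟨ σ21≈ ⟩
      (id 1 ⊗ cap B) ∘ (σ 1 1 ⊗ id 1) ∘ (id 1 ⊗ σ 1 1) ∎
    crossings-cancel : (id 1 ⊗ (id 1 ⊗ σ 1 1)) ∘ (id 2 ⊗ σ 1 1) ≈ id 4
    crossings-cancel = begin
      (id 1 ⊗ (id 1 ⊗ σ 1 1)) ∘ (id 2 ⊗ σ 1 1) ≈⟨ ≈-trans (≈-sym (≅⇒≈ assoc⊗)) (idid ⟩⊗⟨ rfl) ⟩∘⟨ rfl ⟩
      (id 2 ⊗ σ 1 1) ∘ (id 2 ⊗ σ 1 1) ≈˘⟨ whiskL ⟩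
      id 2 ⊗ (σ 1 1 ∘ σ 1 1) ≈⟨ rfl ⟩⊗⟨ σ-inv 1 1 ⟩
      id 2 ⊗ id 2 ≈⟨ idid ⟩
      id 4 ∎
    cap-after-m : m ∘ (id 1 ⊗ (id 1 ⊗ cap B)) ≈ (id 1 ⊗ ε') ∘ (m ⊗ m)
    cap-after-m = begin
      m ∘ (id 1 ⊗ (id 1 ⊗ cap B)) ≈⟨ rfl ⟩∘⟨ ≈-trans (≈-sym (≅⇒≈ assoc⊗)) (idid ⟩⊗⟨ rfl) ⟩
      m ∘ (id 2 ⊗ cap B) ≈˘⟨ ≅⇒≈ unitR≅ ⟩∘⟨ rfl ⟩
      (m ⊗ id 0) ∘ (id 2 ⊗ cap B) ≈˘⟨ splitL ⟩
      m ⊗ (ε' ∘ m) ≈˘⟨ idl ⟩⊗⟨ rfl ⟩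
      (id 1 ∘ m) ⊗ (ε' ∘ m) ≈⟨ ich ⟩
      (id 1 ⊗ ε') ∘ (m ⊗ m) ∎

  counitA-via-B : ε' ∘ m ∘ (i ⊗ id 1) ≈ e
  counitA-via-B = begin
    ε' ∘ m ∘ (i ⊗ id 1) ≈˘⟨ rfl ⟩∘⟨ μ-comm B ⟩∘⟨ rfl ⟩
    ε' ∘ (m ∘ σ 1 1) ∘ (i ⊗ id 1) ≈⟨ rfl ⟩∘⟨ assoc ⟩
    ε' ∘ m ∘ σ 1 1 ∘ (i ⊗ id 1) ≈⟨ rfl ⟩∘⟨ rfl ⟩∘⟨ natσ ⟩
    ε' ∘ m ∘ (id 1 ⊗ i) ∘ σ 0 1 ≈⟨ rfl ⟩∘⟨ rfl ⟩∘⟨ rfl ⟩∘⟨ σ01 ⟩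
    ε' ∘ m ∘ (id 1 ⊗ i) ∘ id 1 ≈⟨ rfl ⟩∘⟨ rfl ⟩∘⟨ idr ⟩
    ε' ∘ m ∘ (id 1 ⊗ i) ≈˘⟨ u2 ⟩
    e ∎

  antipode-left : m ∘ (antipode ⊗ id 1) ∘ Δ ≈ u ∘ e
  antipode-left = begin
    m ∘ (antipode ⊗ id 1) ∘ Δ ≈⟨ rfl ⟩∘⟨ whiskR ⟩∘⟨ rfl ⟩
    m ∘ (((id 1 ⊗ cap B) ⊗ id 1) ∘ ((d A ⊗ id 1) ⊗ id 1)) ∘ Δ ≈⟨ rfl ⟩∘⟨ assoc ⟩
    m ∘ ((id 1 ⊗ cap B) ⊗ id 1) ∘ ((d A ⊗ id 1) ⊗ id 1) ∘ Δ
      ≈⟨ rfl ⟩∘⟨ rfl ⟩∘⟨ ≈-trans ((≈-trans (≅⇒≈ assoc⊗) (rfl ⟩⊗⟨ idid)) ⟩∘⟨ rfl) state-ich ⟩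
    m ∘ ((id 1 ⊗ cap B) ⊗ id 1) ∘ (d A ⊗ Δ) ≈⟨ rfl ⟩∘⟨ rfl ⟩∘⟨ (rfl ⟩⊗⟨ ≈-sym FA.cocomm) ⟩
    m ∘ ((id 1 ⊗ cap B) ⊗ id 1) ∘ (d A ⊗ (σ 1 1 ∘ Δ)) ≈˘⟨ rfl ⟩∘⟨ rfl ⟩∘⟨ fuseʳ' ⟩
    m ∘ ((id 1 ⊗ cap B) ⊗ id 1) ∘ (id 2 ⊗ σ 1 1) ∘ (d A ⊗ Δ) ≈˘⟨ rfl ⟩∘⟨ rfl ⟩∘⟨ rfl ⟩∘⟨ fuseˡ ⟩
    m ∘ ((id 1 ⊗ cap B) ⊗ id 1) ∘ (id 2 ⊗ σ 1 1) ∘ (Δ ⊗ Δ) ∘ (i ⊗ id 1) ≈⟨ rfl ⟩∘⟨ assoc˘ ⟩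
    m ∘ (((id 1 ⊗ cap B) ⊗ id 1) ∘ (id 2 ⊗ σ 1 1)) ∘ (Δ ⊗ Δ) ∘ (i ⊗ id 1) ≈⟨ assoc˘ ⟩
    (m ∘ ((id 1 ⊗ cap B) ⊗ id 1) ∘ (id 2 ⊗ σ 1 1)) ∘ (Δ ⊗ Δ) ∘ (i ⊗ id 1) ≈⟨ antipode-rewire ⟩∘⟨ rfl ⟩
    ((id 1 ⊗ ε') ∘ (m ⊗ m) ∘ ((id 1 ⊗ σ 1 1) ⊗ id 1)) ∘ (Δ ⊗ Δ) ∘ (i ⊗ id 1) ≈⟨ ≈-trans assoc (rfl ⟩∘⟨ ≈-trans assoc (rfl ⟩∘⟨ assoc˘)) ⟩
    (id 1 ⊗ ε') ∘ (m ⊗ m) ∘ (((id 1 ⊗ σ 1 1) ⊗ id 1) ∘ (Δ ⊗ Δ)) ∘ (i ⊗ id 1) ≈⟨ rfl ⟩∘⟨ pullˡ (≈-sym bi) ⟩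
    (id 1 ⊗ ε') ∘ (Δ ∘ m) ∘ (i ⊗ id 1) ≈⟨ rfl ⟩∘⟨ assoc ⟩
    (id 1 ⊗ ε') ∘ Δ ∘ m ∘ (i ⊗ id 1) ≈⟨ assoc˘ ⟩
    ((id 1 ⊗ ε') ∘ Δ) ∘ m ∘ (i ⊗ id 1) ≈⟨ ≈-trans FA.effect-swap (≈-trans εB-copy μA-absorbs-ηB) ⟩∘⟨ rfl ⟩
    (u ∘ ε') ∘ m ∘ (i ⊗ id 1) ≈⟨ assoc ⟩
    u ∘ ε' ∘ m ∘ (i ⊗ id 1) ≈⟨ rfl ⟩∘⟨ counitA-via-B ⟩
    u ∘ e ∎

  antipode-right : m ∘ (id 1 ⊗ antipode) ∘ Δ ≈ u ∘ e
  antipode-right = begin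
    m ∘ (id 1 ⊗ antipode) ∘ Δ ≈˘⟨ μ-comm B ⟩∘⟨ rfl ⟩
    (m ∘ σ 1 1) ∘ (id 1 ⊗ antipode) ∘ Δ ≈⟨ assoc ⟩
    m ∘ σ 1 1 ∘ (id 1 ⊗ antipode) ∘ Δ ≈⟨ rfl ⟩∘⟨ pullˡ natσ ⟩
    m ∘ ((antipode ⊗ id 1) ∘ σ 1 1) ∘ Δ ≈⟨ rfl ⟩∘⟨ assoc ⟩
    m ∘ (antipode ⊗ id 1) ∘ σ 1 1 ∘ Δ ≈⟨ rfl ⟩∘⟨ rfl ⟩∘⟨ FA.cocomm ⟩
    m ∘ (antipode ⊗ id 1) ∘ Δ ≈⟨ antipode-left ⟩
    u ∘ e ∎

  P4 : Tm 4 4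
  P4 = (id 1 ⊗ σ 1 1) ⊗ id 1

  P4≈ : P4 ≈ s2
  P4≈ = ≅⇒≈ assoc⊗

  Δ₂ : Tm 2 4
  Δ₂ = P4 ∘ (Δ ⊗ Δ)

  conv : Tm 2 1 → Tm 2 1 → Tm 2 1
  conv f h = m ∘ (f ⊗ h) ∘ Δ₂

  conv-unit : Tm 2 1
  conv-unit = u ∘ (e ⊗ e)

  conv-cong : ∀ {f f' h h'} → f ≈ f' → h ≈ h' → conv f h ≈ conv f' h'
  conv-cong p q = rfl ⟩∘⟨ (p ⟩⊗⟨ q) ⟩∘⟨ rfl

  e-cross₁ : (e ⊗ id 1) ∘ σ 1 1 ≈ id 1 ⊗ e
  e-cross₁ = ≈-trans (≈-sym natσ) (≈-trans (σ10 ⟩∘⟨ rfl) idl)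

  e-cross₂ : (id 1 ⊗ e) ∘ σ 1 1 ≈ e ⊗ id 1
  e-cross₂ = ≈-trans (≈-sym natσ) (≈-trans (σ01 ⟩∘⟨ rfl) idl)

  Δ₂-counitˡ : ((e ⊗ e) ⊗ id 2) ∘ Δ₂ ≈ id 2
  Δ₂-counitˡ = begin
    ((e ⊗ e) ⊗ id 2) ∘ P4 ∘ (Δ ⊗ Δ) ≈⟨ assoc˘ ⟩
    (((e ⊗ e) ⊗ id 2) ∘ P4) ∘ (Δ ⊗ Δ) ≈⟨ counits-regroup ⟩∘⟨ rfl ⟩
    ((e ⊗ id 1) ⊗ (e ⊗ id 1)) ∘ (Δ ⊗ Δ) ≈⟨ ich˘ ⟩
    ((e ⊗ id 1) ∘ Δ) ⊗ ((e ⊗ id 1) ∘ Δ) ≈⟨ FA.counitL ⟩⊗⟨ FA.counitL ⟩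
    id 1 ⊗ id 1 ≈⟨ idid ⟩
    id 2 ∎
    where
    counits-regroup : ((e ⊗ e) ⊗ id 2) ∘ P4 ≈ (e ⊗ id 1) ⊗ (e ⊗ id 1)
    counits-regroup = begin
      ((e ⊗ e) ⊗ id 2) ∘ P4 ≈⟨ ≈-trans (rfl ⟩⊗⟨ ≈-sym idid) (≅⇒≈ (≅-sym assoc⊗)) ⟩∘⟨ rfl ⟩
      (((e ⊗ e) ⊗ id 1) ⊗ id 1) ∘ ((id 1 ⊗ σ 1 1) ⊗ id 1) ≈⟨ fuseˡ ⟩
      (((e ⊗ e) ⊗ id 1) ∘ (id 1 ⊗ σ 1 1)) ⊗ id 1 ≈⟨ (≅⇒≈ assoc⊗ ⟩∘⟨ rfl) ⟩⊗⟨ rfl ⟩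
      ((e ⊗ (e ⊗ id 1)) ∘ (id 1 ⊗ σ 1 1)) ⊗ id 1 ≈⟨ fuseʳ ⟩⊗⟨ rfl ⟩
      (e ⊗ ((e ⊗ id 1) ∘ σ 1 1)) ⊗ id 1 ≈⟨ (rfl ⟩⊗⟨ e-cross₁) ⟩⊗⟨ rfl ⟩
      (e ⊗ (id 1 ⊗ e)) ⊗ id 1 ≈⟨ ≅⇒≈ (≅-trans assoc⊗ (≅-trans (⊗≅ ≅-refl assoc⊗) (≅-sym assoc⊗))) ⟩
      (e ⊗ id 1) ⊗ (e ⊗ id 1) ∎

  Δ₂-counitʳ : (id 2 ⊗ (e ⊗ e)) ∘ Δ₂ ≈ id 2
  Δ₂-counitʳ = begin
    (id 2 ⊗ (e ⊗ e)) ∘ P4 ∘ (Δ ⊗ Δ) ≈⟨ assoc˘ ⟩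
    ((id 2 ⊗ (e ⊗ e)) ∘ P4) ∘ (Δ ⊗ Δ) ≈⟨ counits-regroup ⟩∘⟨ rfl ⟩
    ((id 1 ⊗ e) ⊗ (id 1 ⊗ e)) ∘ (Δ ⊗ Δ) ≈⟨ ich˘ ⟩
    ((id 1 ⊗ e) ∘ Δ) ⊗ ((id 1 ⊗ e) ∘ Δ) ≈⟨ FA.counitR ⟩⊗⟨ FA.counitR ⟩
    id 1 ⊗ id 1 ≈⟨ idid ⟩
    id 2 ∎
    where
    counits-regroup : (id 2 ⊗ (e ⊗ e)) ∘ P4 ≈ (id 1 ⊗ e) ⊗ (id 1 ⊗ e)
    counits-regroup = begin
      (id 2 ⊗ (e ⊗ e)) ∘ P4 ≈⟨ ≈-trans (≈-sym idid ⟩⊗⟨ rfl) (≅⇒≈ assoc⊗) ⟩∘⟨ P4≈ ⟩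
      (id 1 ⊗ (id 1 ⊗ (e ⊗ e))) ∘ (id 1 ⊗ (σ 1 1 ⊗ id 1)) ≈˘⟨ whiskL ⟩
      id 1 ⊗ ((id 1 ⊗ (e ⊗ e)) ∘ (σ 1 1 ⊗ id 1)) ≈⟨ rfl ⟩⊗⟨ (≅⇒≈ (≅-sym assoc⊗) ⟩∘⟨ rfl) ⟩
      id 1 ⊗ (((id 1 ⊗ e) ⊗ e) ∘ (σ 1 1 ⊗ id 1)) ≈⟨ rfl ⟩⊗⟨ fuseˡ ⟩
      id 1 ⊗ (((id 1 ⊗ e) ∘ σ 1 1) ⊗ e) ≈⟨ rfl ⟩⊗⟨ (e-cross₂ ⟩⊗⟨ rfl) ⟩
      id 1 ⊗ ((e ⊗ id 1) ⊗ e) ≈⟨ ≅⇒≈ (≅-trans (⊗≅ ≅-refl assoc⊗) (≅-sym assoc⊗)) ⟩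
      (id 1 ⊗ e) ⊗ (id 1 ⊗ e) ∎

  conv-unitˡ : ∀ {f} → conv conv-unit f ≈ f
  conv-unitˡ {f} = begin
    m ∘ ((u ∘ (e ⊗ e)) ⊗ f) ∘ Δ₂ ≈˘⟨ rfl ⟩∘⟨ fuseˡ' ⟩∘⟨ rfl ⟩
    m ∘ ((u ⊗ id 1) ∘ ((e ⊗ e) ⊗ f)) ∘ Δ₂ ≈⟨ ≈-trans (rfl ⟩∘⟨ assoc) assoc˘ ⟩
    (m ∘ (u ⊗ id 1)) ∘ ((e ⊗ e) ⊗ f) ∘ Δ₂ ≈⟨ μ-unit B ⟩∘⟨ rfl ⟩
    id 1 ∘ ((e ⊗ e) ⊗ f) ∘ Δ₂ ≈⟨ idl ⟩
    ((e ⊗ e) ⊗ f) ∘ Δ₂ ≈⟨ ≈-trans splitR (⊗-unitˡ _ ⟩∘⟨ rfl) ⟩∘⟨ rfl ⟩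
    (f ∘ ((e ⊗ e) ⊗ id 2)) ∘ Δ₂ ≈⟨ assoc ⟩
    f ∘ ((e ⊗ e) ⊗ id 2) ∘ Δ₂ ≈⟨ rfl ⟩∘⟨ Δ₂-counitˡ ⟩
    f ∘ id 2 ≈⟨ idr ⟩
    f ∎

  conv-unitʳ : ∀ {f} → conv f conv-unit ≈ f
  conv-unitʳ {f} = begin
    m ∘ (f ⊗ (u ∘ (e ⊗ e))) ∘ Δ₂ ≈˘⟨ rfl ⟩∘⟨ fuseʳ' ⟩∘⟨ rfl ⟩
    m ∘ ((id 1 ⊗ u) ∘ (f ⊗ (e ⊗ e))) ∘ Δ₂ ≈⟨ ≈-trans (rfl ⟩∘⟨ assoc) assoc˘ ⟩
    (m ∘ (id 1 ⊗ u)) ∘ (f ⊗ (e ⊗ e)) ∘ Δ₂ ≈⟨ FB.unitR ⟩∘⟨ rfl ⟩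
    id 1 ∘ (f ⊗ (e ⊗ e)) ∘ Δ₂ ≈⟨ idl ⟩
    (f ⊗ (e ⊗ e)) ∘ Δ₂ ≈⟨ ≈-trans splitL (≅⇒≈ unitR≅ ⟩∘⟨ rfl) ⟩∘⟨ rfl ⟩
    (f ∘ (id 2 ⊗ (e ⊗ e))) ∘ Δ₂ ≈⟨ assoc ⟩
    f ∘ (id 2 ⊗ (e ⊗ e)) ∘ Δ₂ ≈⟨ rfl ⟩∘⟨ Δ₂-counitʳ ⟩
    f ∘ id 2 ≈⟨ idr ⟩
    f ∎

  -- Coassociativity of Δ₂: both composites equal Δ₃ ⊗ Δ₃ followed by crossings,
  -- and the crossings differ only by the commuting pair w1, w3.
  w1 w2 w3 : Tm 6 6
  w1 = id 1 ⊗ (σ 1 1 ⊗ id 3)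
  w2 = id 2 ⊗ (σ 1 1 ⊗ id 2)
  w3 = id 3 ⊗ (σ 1 1 ⊗ id 1)

  w₁₃-commute : w1 ∘ w3 ≈ w3 ∘ w1
  w₁₃-commute = begin
    w1 ∘ w3 ≈⟨ rfl ⟩∘⟨ ≅⇒≈ (≅-trans (⊗≅ (idsplit {1} {2}) ≅-refl) assoc⊗) ⟩
    w1 ∘ (id 1 ⊗ (id 2 ⊗ (σ 1 1 ⊗ id 1))) ≈˘⟨ whiskL ⟩
    id 1 ⊗ ((σ 1 1 ⊗ id 3) ∘ (id 2 ⊗ (σ 1 1 ⊗ id 1))) ≈˘⟨ rfl ⟩⊗⟨ splitL ⟩
    id 1 ⊗ (σ 1 1 ⊗ (σ 1 1 ⊗ id 1)) ≈⟨ rfl ⟩⊗⟨ splitR ⟩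
    id 1 ⊗ ((id 2 ⊗ (σ 1 1 ⊗ id 1)) ∘ (σ 1 1 ⊗ id 3)) ≈⟨ whiskL ⟩
    (id 1 ⊗ (id 2 ⊗ (σ 1 1 ⊗ id 1))) ∘ w1 ≈˘⟨ ≅⇒≈ (≅-trans (⊗≅ (idsplit {1} {2}) ≅-refl) assoc⊗) ⟩∘⟨ rfl ⟩
    w3 ∘ w1 ∎

  Δ₃ : Tm 1 3
  Δ₃ = (Δ ⊗ id 1) ∘ Δ

  Δ₂-coassocˡ : (Δ₂ ⊗ id 2) ∘ Δ₂ ≈ (w1 ∘ w3 ∘ w2) ∘ (Δ₃ ⊗ Δ₃)
  Δ₂-coassocˡ = begin
    ((P4 ∘ (Δ ⊗ Δ)) ⊗ id 2) ∘ P4 ∘ (Δ ⊗ Δ) ≈⟨ whiskR ⟩∘⟨ rfl ⟩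
    ((P4 ⊗ id 2) ∘ ((Δ ⊗ Δ) ⊗ id 2)) ∘ P4 ∘ (Δ ⊗ Δ) ≈⟨ ≈-trans assoc (rfl ⟩∘⟨ assoc˘) ⟩
    (P4 ⊗ id 2) ∘ (((Δ ⊗ Δ) ⊗ id 2) ∘ P4) ∘ (Δ ⊗ Δ) ≈⟨ rfl ⟩∘⟨ Δs-past-shuffle ⟩∘⟨ rfl ⟩
    (P4 ⊗ id 2) ∘ ((w3 ∘ w2) ∘ ((Δ ⊗ id 1) ⊗ (Δ ⊗ id 1))) ∘ (Δ ⊗ Δ) ≈⟨ rfl ⟩∘⟨ ≈-trans assoc (≈-trans assoc (rfl ⟩∘⟨ rfl ⟩∘⟨ ich˘)) ⟩
    (P4 ⊗ id 2) ∘ w3 ∘ w2 ∘ (Δ₃ ⊗ Δ₃) ≈⟨ shuffle-as-w1 ⟩∘⟨ rfl ⟩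
    w1 ∘ w3 ∘ w2 ∘ (Δ₃ ⊗ Δ₃) ≈⟨ ≈-trans (rfl ⟩∘⟨ assoc˘) assoc˘ ⟩
    (w1 ∘ w3 ∘ w2) ∘ (Δ₃ ⊗ Δ₃) ∎
    where
    shuffle-as-w1 : P4 ⊗ id 2 ≈ w1
    shuffle-as-w1 = ≅⇒≈ (≅-trans assoc⊗ (≅-trans assoc⊗ (⊗≅ ≅-refl (⊗≅ ≅-refl idid≅))))
    Δs-past-shuffle : ((Δ ⊗ Δ) ⊗ id 2) ∘ P4 ≈ (w3 ∘ w2) ∘ ((Δ ⊗ id 1) ⊗ (Δ ⊗ id 1))
    Δs-past-shuffle = begin
      ((Δ ⊗ Δ) ⊗ id 2) ∘ P4 ≈⟨ ≅⇒≈ assoc⊗ ⟩∘⟨ P4≈ ⟩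
      (Δ ⊗ (Δ ⊗ id 2)) ∘ (id 1 ⊗ (σ 1 1 ⊗ id 1)) ≈⟨ fuseʳ ⟩
      Δ ⊗ ((Δ ⊗ id 2) ∘ (σ 1 1 ⊗ id 1)) ≈⟨ rfl ⟩⊗⟨ (≈-trans (rfl ⟩⊗⟨ ≈-sym idid) (≅⇒≈ (≅-sym assoc⊗)) ⟩∘⟨ rfl) ⟩
      Δ ⊗ (((Δ ⊗ id 1) ⊗ id 1) ∘ (σ 1 1 ⊗ id 1)) ≈⟨ rfl ⟩⊗⟨ fuseˡ ⟩
      Δ ⊗ (((Δ ⊗ id 1) ∘ σ 1 1) ⊗ id 1) ≈˘⟨ rfl ⟩⊗⟨ (natσ ⟩⊗⟨ rfl) ⟩
      Δ ⊗ ((σ 1 2 ∘ (id 1 ⊗ Δ)) ⊗ id 1) ≈⟨ rfl ⟩⊗⟨ whiskR ⟩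
      Δ ⊗ ((σ 1 2 ⊗ id 1) ∘ ((id 1 ⊗ Δ) ⊗ id 1)) ≈˘⟨ fuseʳ' ⟩
      (id 2 ⊗ (σ 1 2 ⊗ id 1)) ∘ (Δ ⊗ ((id 1 ⊗ Δ) ⊗ id 1)) ≈⟨ crossing-as-w ⟩∘⟨ ≅⇒≈ (≅-trans (⊗≅ ≅-refl assoc⊗) (≅-sym assoc⊗)) ⟩
      (w3 ∘ w2) ∘ ((Δ ⊗ id 1) ⊗ (Δ ⊗ id 1)) ∎
      where
      crossing-as-w : id 2 ⊗ (σ 1 2 ⊗ id 1) ≈ w3 ∘ w2
      crossing-as-w = begin
        id 2 ⊗ (σ 1 2 ⊗ id 1) ≈⟨ rfl ⟩⊗⟨ (σ12≈ ⟩⊗⟨ rfl) ⟩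
        id 2 ⊗ (((id 1 ⊗ σ 1 1) ∘ (σ 1 1 ⊗ id 1)) ⊗ id 1) ≈⟨ ≈-trans (rfl ⟩⊗⟨ whiskR) whiskL ⟩
        (id 2 ⊗ ((id 1 ⊗ σ 1 1) ⊗ id 1)) ∘ (id 2 ⊗ ((σ 1 1 ⊗ id 1) ⊗ id 1))
          ≈⟨ ≅⇒≈ (≅-trans (⊗≅ ≅-refl assoc⊗) (≅-trans (≅-sym assoc⊗) (⊗≅ idid≅ ≅-refl)))
             ⟩∘⟨ ≅⇒≈ (⊗≅ ≅-refl (≅-trans assoc⊗ (⊗≅ ≅-refl idid≅))) ⟩
        w3 ∘ w2 ∎

  Δ₂-coassocʳ : (id 2 ⊗ Δ₂) ∘ Δ₂ ≈ (w3 ∘ w1 ∘ w2) ∘ (Δ₃ ⊗ Δ₃)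
  Δ₂-coassocʳ = begin
    (id 2 ⊗ (P4 ∘ (Δ ⊗ Δ))) ∘ P4 ∘ (Δ ⊗ Δ) ≈⟨ whiskL ⟩∘⟨ rfl ⟩
    ((id 2 ⊗ P4) ∘ (id 2 ⊗ (Δ ⊗ Δ))) ∘ P4 ∘ (Δ ⊗ Δ) ≈⟨ ≈-trans assoc (rfl ⟩∘⟨ assoc˘) ⟩
    (id 2 ⊗ P4) ∘ ((id 2 ⊗ (Δ ⊗ Δ)) ∘ P4) ∘ (Δ ⊗ Δ) ≈⟨ rfl ⟩∘⟨ Δs-past-shuffle ⟩∘⟨ rfl ⟩
    (id 2 ⊗ P4) ∘ ((w1 ∘ w2) ∘ ((id 1 ⊗ Δ) ⊗ (id 1 ⊗ Δ))) ∘ (Δ ⊗ Δ) ≈⟨ rfl ⟩∘⟨ ≈-trans assoc (≈-trans assoc (rfl ⟩∘⟨ rfl ⟩∘⟨ ≈-trans ich˘ (≈-sym FA.coassoc ⟩⊗⟨ ≈-sym FA.coassoc))) ⟩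
    (id 2 ⊗ P4) ∘ w1 ∘ w2 ∘ (Δ₃ ⊗ Δ₃) ≈⟨ shuffle-as-w3 ⟩∘⟨ rfl ⟩
    w3 ∘ w1 ∘ w2 ∘ (Δ₃ ⊗ Δ₃) ≈⟨ ≈-trans (rfl ⟩∘⟨ assoc˘) assoc˘ ⟩
    (w3 ∘ w1 ∘ w2) ∘ (Δ₃ ⊗ Δ₃) ∎
    where
    shuffle-as-w3 : id 2 ⊗ P4 ≈ w3
    shuffle-as-w3 = ≅⇒≈ (≅-trans (⊗≅ ≅-refl assoc⊗) (≅-trans (≅-sym assoc⊗) (⊗≅ idid≅ ≅-refl)))
    Δs-past-shuffle : (id 2 ⊗ (Δ ⊗ Δ)) ∘ P4 ≈ (w1 ∘ w2) ∘ ((id 1 ⊗ Δ) ⊗ (id 1 ⊗ Δ))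
    Δs-past-shuffle = begin
      (id 2 ⊗ (Δ ⊗ Δ)) ∘ P4 ≈⟨ ≈-trans (≈-sym idid ⟩⊗⟨ rfl) (≅⇒≈ assoc⊗) ⟩∘⟨ P4≈ ⟩
      (id 1 ⊗ (id 1 ⊗ (Δ ⊗ Δ))) ∘ (id 1 ⊗ (σ 1 1 ⊗ id 1)) ≈˘⟨ whiskL ⟩
      id 1 ⊗ ((id 1 ⊗ (Δ ⊗ Δ)) ∘ (σ 1 1 ⊗ id 1)) ≈⟨ rfl ⟩⊗⟨ (≅⇒≈ (≅-sym assoc⊗) ⟩∘⟨ rfl) ⟩
      id 1 ⊗ (((id 1 ⊗ Δ) ⊗ Δ) ∘ (σ 1 1 ⊗ id 1)) ≈⟨ rfl ⟩⊗⟨ fuseˡ ⟩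
      id 1 ⊗ (((id 1 ⊗ Δ) ∘ σ 1 1) ⊗ Δ) ≈˘⟨ rfl ⟩⊗⟨ (natσ ⟩⊗⟨ rfl) ⟩
      id 1 ⊗ ((σ 2 1 ∘ (Δ ⊗ id 1)) ⊗ Δ) ≈˘⟨ rfl ⟩⊗⟨ fuseˡ' ⟩
      id 1 ⊗ ((σ 2 1 ⊗ id 2) ∘ ((Δ ⊗ id 1) ⊗ Δ)) ≈⟨ whiskL ⟩
      (id 1 ⊗ (σ 2 1 ⊗ id 2)) ∘ (id 1 ⊗ ((Δ ⊗ id 1) ⊗ Δ)) ≈⟨ crossing-as-w ⟩∘⟨ ≅⇒≈ (≅-trans (⊗≅ ≅-refl assoc⊗) (≅-sym assoc⊗)) ⟩
      (w1 ∘ w2) ∘ ((id 1 ⊗ Δ) ⊗ (id 1 ⊗ Δ)) ∎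
      where
      crossing-as-w : id 1 ⊗ (σ 2 1 ⊗ id 2) ≈ w1 ∘ w2
      crossing-as-w = begin
        id 1 ⊗ (σ 2 1 ⊗ id 2) ≈⟨ rfl ⟩⊗⟨ (σ21≈ ⟩⊗⟨ rfl) ⟩
        id 1 ⊗ (((σ 1 1 ⊗ id 1) ∘ (id 1 ⊗ σ 1 1)) ⊗ id 2) ≈⟨ ≈-trans (rfl ⟩⊗⟨ whiskR) whiskL ⟩
        (id 1 ⊗ ((σ 1 1 ⊗ id 1) ⊗ id 2)) ∘ (id 1 ⊗ ((id 1 ⊗ σ 1 1) ⊗ id 2))
          ≈⟨ ≅⇒≈ (⊗≅ ≅-refl (≅-trans assoc⊗ (⊗≅ ≅-refl idid≅)))
             ⟩∘⟨ ≅⇒≈ (≅-trans (⊗≅ ≅-refl assoc⊗) (≅-trans (≅-sym assoc⊗) (⊗≅ idid≅ ≅-refl))) ⟩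
        w1 ∘ w2 ∎

  Δ₂-coassoc : (Δ₂ ⊗ id 2) ∘ Δ₂ ≈ (id 2 ⊗ Δ₂) ∘ Δ₂
  Δ₂-coassoc = ≈-trans Δ₂-coassocˡ (≈-trans (≈-trans assoc˘ (w₁₃-commute ⟩∘⟨ rfl) ⟩∘⟨ rfl) (≈-trans ((≈-trans assoc rfl) ⟩∘⟨ rfl) (≈-sym Δ₂-coassocʳ)))

  conv-assoc : ∀ {f h k} → conv (conv f h) k ≈ conv f (conv h k)
  conv-assoc {f} {h} {k} = begin
    m ∘ ((m ∘ (f ⊗ h) ∘ Δ₂) ⊗ k) ∘ Δ₂ ≈⟨ rfl ⟩∘⟨ regroup-left ⟩∘⟨ rfl ⟩
    m ∘ ((m ⊗ id 1) ∘ ((f ⊗ h) ⊗ k) ∘ (Δ₂ ⊗ id 2)) ∘ Δ₂ ≈⟨ ≈-trans (rfl ⟩∘⟨ ≈-trans assoc (rfl ⟩∘⟨ assoc)) assoc˘ ⟩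
    (m ∘ (m ⊗ id 1)) ∘ ((f ⊗ h) ⊗ k) ∘ (Δ₂ ⊗ id 2) ∘ Δ₂ ≈⟨ μ-assoc B ⟩∘⟨ ≅⇒≈ assoc⊗ ⟩∘⟨ Δ₂-coassoc ⟩
    (m ∘ (id 1 ⊗ m)) ∘ (f ⊗ (h ⊗ k)) ∘ (id 2 ⊗ Δ₂) ∘ Δ₂ ≈˘⟨ ≈-trans (rfl ⟩∘⟨ ≈-trans assoc (rfl ⟩∘⟨ assoc)) assoc˘ ⟩
    m ∘ ((id 1 ⊗ m) ∘ (f ⊗ (h ⊗ k)) ∘ (id 2 ⊗ Δ₂)) ∘ Δ₂ ≈˘⟨ rfl ⟩∘⟨ regroup-right ⟩∘⟨ rfl ⟩
    m ∘ (f ⊗ (m ∘ (h ⊗ k) ∘ Δ₂)) ∘ Δ₂ ∎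
    where
    regroup-left : (m ∘ (f ⊗ h) ∘ Δ₂) ⊗ k ≈ (m ⊗ id 1) ∘ ((f ⊗ h) ⊗ k) ∘ (Δ₂ ⊗ id 2)
    regroup-left = begin
      (m ∘ (f ⊗ h) ∘ Δ₂) ⊗ k ≈˘⟨ rfl ⟩⊗⟨ ≈-trans idl idr ⟩
      (m ∘ (f ⊗ h) ∘ Δ₂) ⊗ (id 1 ∘ k ∘ id 2) ≈⟨ ich ⟩
      (m ⊗ id 1) ∘ (((f ⊗ h) ∘ Δ₂) ⊗ (k ∘ id 2)) ≈⟨ rfl ⟩∘⟨ ich ⟩
      (m ⊗ id 1) ∘ ((f ⊗ h) ⊗ k) ∘ (Δ₂ ⊗ id 2) ∎
    regroup-right : f ⊗ (m ∘ (h ⊗ k) ∘ Δ₂) ≈ (id 1 ⊗ m) ∘ (f ⊗ (h ⊗ k)) ∘ (id 2 ⊗ Δ₂)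
    regroup-right = begin
      f ⊗ (m ∘ (h ⊗ k) ∘ Δ₂) ≈˘⟨ ≈-trans idl idr ⟩⊗⟨ rfl ⟩
      (id 1 ∘ f ∘ id 2) ⊗ (m ∘ (h ⊗ k) ∘ Δ₂) ≈⟨ ich ⟩
      (id 1 ⊗ m) ∘ ((f ∘ id 2) ⊗ ((h ⊗ k) ∘ Δ₂)) ≈⟨ rfl ⟩∘⟨ ich ⟩
      (id 1 ⊗ m) ∘ (f ⊗ (h ⊗ k)) ∘ (id 2 ⊗ Δ₂) ∎

  μ₃ : Tm 3 1
  μ₃ = m ∘ (m ⊗ id 1)

  μ∘μ⊗μ : m ∘ (m ⊗ m) ≈ m ∘ (id 1 ⊗ μ₃)
  μ∘μ⊗μ = begin
    m ∘ (m ⊗ m) ≈⟨ rfl ⟩∘⟨ splitL ⟩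
    m ∘ (m ⊗ id 1) ∘ (id 2 ⊗ m) ≈⟨ assoc˘ ⟩
    (m ∘ (m ⊗ id 1)) ∘ (id 2 ⊗ m) ≈⟨ μ-assoc B ⟩∘⟨ ≈-trans (≈-sym idid ⟩⊗⟨ rfl) (≅⇒≈ assoc⊗) ⟩
    (m ∘ (id 1 ⊗ m)) ∘ (id 1 ⊗ (id 1 ⊗ m)) ≈⟨ assoc ⟩
    m ∘ (id 1 ⊗ m) ∘ (id 1 ⊗ (id 1 ⊗ m)) ≈˘⟨ rfl ⟩∘⟨ whiskL ⟩
    m ∘ (id 1 ⊗ (m ∘ (id 1 ⊗ m))) ≈˘⟨ rfl ⟩∘⟨ (rfl ⟩⊗⟨ μ-assoc B) ⟩
    m ∘ (id 1 ⊗ μ₃) ∎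

  μμ-shuffle : m ∘ (m ⊗ m) ∘ P4 ≈ m ∘ (m ⊗ m)
  μμ-shuffle = begin
    m ∘ (m ⊗ m) ∘ P4 ≈⟨ assoc˘ ⟩
    (m ∘ (m ⊗ m)) ∘ P4 ≈⟨ μ∘μ⊗μ ⟩∘⟨ P4≈ ⟩
    (m ∘ (id 1 ⊗ μ₃)) ∘ (id 1 ⊗ (σ 1 1 ⊗ id 1)) ≈⟨ assoc ⟩
    m ∘ (id 1 ⊗ μ₃) ∘ (id 1 ⊗ (σ 1 1 ⊗ id 1)) ≈˘⟨ rfl ⟩∘⟨ whiskL ⟩
    m ∘ (id 1 ⊗ (μ₃ ∘ (σ 1 1 ⊗ id 1))) ≈⟨ rfl ⟩∘⟨ (rfl ⟩⊗⟨ ≈-trans assoc (rfl ⟩∘⟨ ≈-trans (≈-sym whiskR) (μ-comm B ⟩⊗⟨ rfl))) ⟩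
    m ∘ (id 1 ⊗ μ₃) ≈˘⟨ μ∘μ⊗μ ⟩
    m ∘ (m ⊗ m) ∎

  P4P4 : P4 ∘ P4 ≈ id 4
  P4P4 = ≈-trans (P4≈ ⟩∘⟨ P4≈) s2-invol

  antipodes-shuffle : (id 2 ⊗ (antipode ⊗ antipode)) ∘ P4 ≈ P4 ∘ ((id 1 ⊗ antipode) ⊗ (id 1 ⊗ antipode))
  antipodes-shuffle = begin
    (id 2 ⊗ (antipode ⊗ antipode)) ∘ P4 ≈⟨ ≈-trans (≈-sym idid ⟩⊗⟨ rfl) (≅⇒≈ assoc⊗) ⟩∘⟨ P4≈ ⟩
    (id 1 ⊗ (id 1 ⊗ (antipode ⊗ antipode))) ∘ (id 1 ⊗ (σ 1 1 ⊗ id 1)) ≈˘⟨ whiskL ⟩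
    id 1 ⊗ ((id 1 ⊗ (antipode ⊗ antipode)) ∘ (σ 1 1 ⊗ id 1)) ≈⟨ rfl ⟩⊗⟨ (≅⇒≈ (≅-sym assoc⊗) ⟩∘⟨ rfl) ⟩
    id 1 ⊗ (((id 1 ⊗ antipode) ⊗ antipode) ∘ (σ 1 1 ⊗ id 1)) ≈⟨ rfl ⟩⊗⟨ fuseˡ ⟩
    id 1 ⊗ (((id 1 ⊗ antipode) ∘ σ 1 1) ⊗ antipode) ≈˘⟨ rfl ⟩⊗⟨ (natσ ⟩⊗⟨ rfl) ⟩
    id 1 ⊗ ((σ 1 1 ∘ (antipode ⊗ id 1)) ⊗ antipode) ≈˘⟨ rfl ⟩⊗⟨ fuseˡ' ⟩
    id 1 ⊗ ((σ 1 1 ⊗ id 1) ∘ ((antipode ⊗ id 1) ⊗ antipode)) ≈⟨ whiskL ⟩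
    (id 1 ⊗ (σ 1 1 ⊗ id 1)) ∘ (id 1 ⊗ ((antipode ⊗ id 1) ⊗ antipode)) ≈⟨ ≈-sym P4≈ ⟩∘⟨ ≅⇒≈ (≅-trans (⊗≅ ≅-refl assoc⊗) (≅-sym assoc⊗)) ⟩
    P4 ∘ ((id 1 ⊗ antipode) ⊗ (id 1 ⊗ antipode)) ∎

  μ-units : m ∘ (u ⊗ u) ≈ u
  μ-units = begin
    m ∘ (u ⊗ u) ≈˘⟨ rfl ⟩∘⟨ state-ich ⟩
    m ∘ (u ⊗ id 1) ∘ u ≈⟨ pullˡ (μ-unit B) ⟩
    id 1 ∘ u ≈⟨ idl ⟩
    u ∎

  -- antipode ∘ m is a left convolution inverse of m (bialgebra law + antipode law) …
  antipode∘μ⋆μ : conv (antipode ∘ m) m ≈ conv-unit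
  antipode∘μ⋆μ = begin
    m ∘ ((antipode ∘ m) ⊗ m) ∘ Δ₂ ≈˘⟨ rfl ⟩∘⟨ fuseˡ' ⟩∘⟨ rfl ⟩
    m ∘ ((antipode ⊗ id 1) ∘ (m ⊗ m)) ∘ Δ₂ ≈⟨ rfl ⟩∘⟨ assoc ⟩
    m ∘ (antipode ⊗ id 1) ∘ (m ⊗ m) ∘ Δ₂ ≈˘⟨ rfl ⟩∘⟨ rfl ⟩∘⟨ bi ⟩
    m ∘ (antipode ⊗ id 1) ∘ Δ ∘ m ≈⟨ ≈-trans (rfl ⟩∘⟨ assoc˘) assoc˘ ⟩
    (m ∘ (antipode ⊗ id 1) ∘ Δ) ∘ m ≈⟨ antipode-left ⟩∘⟨ rfl ⟩
    (u ∘ e) ∘ m ≈⟨ assoc ⟩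
    u ∘ e ∘ m ≈⟨ rfl ⟩∘⟨ dl ⟩
    conv-unit ∎

  -- … and m ∘ (antipode ⊗ antipode) is a right one (commutativity of m).
  μ⋆μ∘antipodes : conv m (m ∘ (antipode ⊗ antipode)) ≈ conv-unit
  μ⋆μ∘antipodes = begin
    m ∘ (m ⊗ (m ∘ (antipode ⊗ antipode))) ∘ Δ₂ ≈˘⟨ rfl ⟩∘⟨ ((idr ⟩⊗⟨ rfl) ⟩∘⟨ rfl) ⟩
    m ∘ ((m ∘ id 2) ⊗ (m ∘ (antipode ⊗ antipode))) ∘ Δ₂ ≈⟨ rfl ⟩∘⟨ (ich ⟩∘⟨ rfl) ⟩
    m ∘ ((m ⊗ m) ∘ (id 2 ⊗ (antipode ⊗ antipode))) ∘ P4 ∘ (Δ ⊗ Δ) ≈⟨ ≈-trans (rfl ⟩∘⟨ assoc) assoc˘ ⟩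
    (m ∘ (m ⊗ m)) ∘ (id 2 ⊗ (antipode ⊗ antipode)) ∘ P4 ∘ (Δ ⊗ Δ) ≈˘⟨ ≈-trans assoc μμ-shuffle ⟩∘⟨ rfl ⟩
    ((m ∘ (m ⊗ m)) ∘ P4) ∘ (id 2 ⊗ (antipode ⊗ antipode)) ∘ P4 ∘ (Δ ⊗ Δ) ≈⟨ assoc ⟩
    (m ∘ (m ⊗ m)) ∘ P4 ∘ (id 2 ⊗ (antipode ⊗ antipode)) ∘ P4 ∘ (Δ ⊗ Δ) ≈⟨ rfl ⟩∘⟨ rfl ⟩∘⟨ pullˡ antipodes-shuffle ⟩
    (m ∘ (m ⊗ m)) ∘ P4 ∘ (P4 ∘ ((id 1 ⊗ antipode) ⊗ (id 1 ⊗ antipode))) ∘ (Δ ⊗ Δ) ≈⟨ rfl ⟩∘⟨ rfl ⟩∘⟨ assoc ⟩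
    (m ∘ (m ⊗ m)) ∘ P4 ∘ P4 ∘ ((id 1 ⊗ antipode) ⊗ (id 1 ⊗ antipode)) ∘ (Δ ⊗ Δ) ≈⟨ rfl ⟩∘⟨ pullˡ P4P4 ⟩
    (m ∘ (m ⊗ m)) ∘ id 4 ∘ ((id 1 ⊗ antipode) ⊗ (id 1 ⊗ antipode)) ∘ (Δ ⊗ Δ) ≈⟨ rfl ⟩∘⟨ idl ⟩
    (m ∘ (m ⊗ m)) ∘ ((id 1 ⊗ antipode) ⊗ (id 1 ⊗ antipode)) ∘ (Δ ⊗ Δ) ≈⟨ assoc ⟩
    m ∘ (m ⊗ m) ∘ ((id 1 ⊗ antipode) ⊗ (id 1 ⊗ antipode)) ∘ (Δ ⊗ Δ) ≈⟨ rfl ⟩∘⟨ rfl ⟩∘⟨ ich˘ ⟩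
    m ∘ (m ⊗ m) ∘ (((id 1 ⊗ antipode) ∘ Δ) ⊗ ((id 1 ⊗ antipode) ∘ Δ)) ≈⟨ rfl ⟩∘⟨ ich˘ ⟩
    m ∘ ((m ∘ (id 1 ⊗ antipode) ∘ Δ) ⊗ (m ∘ (id 1 ⊗ antipode) ∘ Δ)) ≈⟨ rfl ⟩∘⟨ (antipode-right ⟩⊗⟨ antipode-right) ⟩
    m ∘ ((u ∘ e) ⊗ (u ∘ e)) ≈⟨ rfl ⟩∘⟨ ich ⟩
    m ∘ (u ⊗ u) ∘ (e ⊗ e) ≈⟨ pullˡ μ-units ⟩
    conv-unit ∎

  -- Hence the two inverses coincide: the antipode is a homomorphism for m.
  antipode-hom : antipode ∘ m ≈ m ∘ (antipode ⊗ antipode)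
  antipode-hom = begin
    antipode ∘ m ≈˘⟨ conv-unitʳ ⟩
    conv (antipode ∘ m) conv-unit ≈˘⟨ conv-cong rfl μ⋆μ∘antipodes ⟩
    conv (antipode ∘ m) (conv m (m ∘ (antipode ⊗ antipode))) ≈˘⟨ conv-assoc ⟩
    conv (conv (antipode ∘ m) m) (m ∘ (antipode ⊗ antipode)) ≈⟨ conv-cong antipode∘μ⋆μ rfl ⟩
    conv conv-unit (m ∘ (antipode ⊗ antipode)) ≈⟨ conv-unitˡ ⟩
    m ∘ (antipode ⊗ antipode) ∎

  module CA = SmallCups A
  module CB = SmallCups B

  antipodes-pass-s2 : s2 ∘ ((antipode ⊗ id 1) ⊗ (antipode ⊗ id 1)) ≈ ((antipode ⊗ antipode) ⊗ id 2) ∘ s2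
  antipodes-pass-s2 = begin
    s2 ∘ ((antipode ⊗ id 1) ⊗ (antipode ⊗ id 1)) ≈⟨ rfl ⟩∘⟨ ≅⇒≈ assoc⊗ ⟩
    (id 1 ⊗ (σ 1 1 ⊗ id 1)) ∘ (antipode ⊗ (id 1 ⊗ (antipode ⊗ id 1))) ≈⟨ fuseʳ' ⟩
    antipode ⊗ ((σ 1 1 ⊗ id 1) ∘ (id 1 ⊗ (antipode ⊗ id 1))) ≈⟨ rfl ⟩⊗⟨ (rfl ⟩∘⟨ ≅⇒≈ (≅-sym assoc⊗)) ⟩
    antipode ⊗ ((σ 1 1 ⊗ id 1) ∘ ((id 1 ⊗ antipode) ⊗ id 1)) ≈˘⟨ rfl ⟩⊗⟨ whiskR ⟩
    antipode ⊗ ((σ 1 1 ∘ (id 1 ⊗ antipode)) ⊗ id 1) ≈⟨ rfl ⟩⊗⟨ (natσ ⟩⊗⟨ rfl) ⟩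
    antipode ⊗ (((antipode ⊗ id 1) ∘ σ 1 1) ⊗ id 1) ≈⟨ rfl ⟩⊗⟨ whiskR ⟩
    antipode ⊗ (((antipode ⊗ id 1) ⊗ id 1) ∘ (σ 1 1 ⊗ id 1)) ≈˘⟨ rfl ⟩⊗⟨ (≈-trans (rfl ⟩⊗⟨ ≈-sym idid) (≅⇒≈ (≅-sym assoc⊗)) ⟩∘⟨ rfl) ⟩
    antipode ⊗ ((antipode ⊗ id 2) ∘ (σ 1 1 ⊗ id 1)) ≈˘⟨ fuseʳ ⟩
    (antipode ⊗ (antipode ⊗ id 2)) ∘ (id 1 ⊗ (σ 1 1 ⊗ id 1)) ≈˘⟨ ≅⇒≈ assoc⊗ ⟩∘⟨ rfl ⟩
    ((antipode ⊗ antipode) ⊗ id 2) ∘ s2 ∎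

  -- μ B slides along the A-cups: rewrite the A-cups as antipodes applied to B-cups,
  -- pull the antipodes through μ B as a homomorphism, and use that μ B slides along
  -- its own cups.
  μ-slides-cross : Sliding.Slides A (μ B)
  μ-slides-cross = begin
    (μ B ⊗ id 2) ∘ dⁿ A 2 ≈⟨ rfl ⟩∘⟨ CA.d²≈ ⟩
    (μ B ⊗ id 2) ∘ s2 ∘ (d A ⊗ d A) ≈⟨ rfl ⟩∘⟨ rfl ⟩∘⟨ (cup-via-antipode ⟩⊗⟨ cup-via-antipode) ⟩
    (μ B ⊗ id 2) ∘ s2 ∘ (((antipode ⊗ id 1) ∘ d B) ⊗ ((antipode ⊗ id 1) ∘ d B)) ≈⟨ rfl ⟩∘⟨ rfl ⟩∘⟨ ich ⟩
    (μ B ⊗ id 2) ∘ s2 ∘ ((antipode ⊗ id 1) ⊗ (antipode ⊗ id 1)) ∘ (d B ⊗ d B) ≈⟨ rfl ⟩∘⟨ ≈-trans (pullˡ antipodes-pass-s2) assoc ⟩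
    (μ B ⊗ id 2) ∘ ((antipode ⊗ antipode) ⊗ id 2) ∘ s2 ∘ (d B ⊗ d B) ≈⟨ pullˡ (≈-trans (≈-sym whiskR) (≈-trans (≈-sym antipode-hom ⟩⊗⟨ rfl) whiskR)) ⟩
    ((antipode ⊗ id 2) ∘ (μ B ⊗ id 2)) ∘ s2 ∘ (d B ⊗ d B) ≈⟨ assoc ⟩
    (antipode ⊗ id 2) ∘ (μ B ⊗ id 2) ∘ s2 ∘ (d B ⊗ d B) ≈˘⟨ rfl ⟩∘⟨ rfl ⟩∘⟨ CB.d²≈ ⟩
    (antipode ⊗ id 2) ∘ (μ B ⊗ id 2) ∘ dⁿ B 2 ≈⟨ rfl ⟩∘⟨ CB.μ-slides ⟩
    (antipode ⊗ id 2) ∘ (id 1 ⊗ δ B) ∘ dⁿ B 1 ≈⟨ pullˡ slide ⟩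
    ((id 1 ⊗ δ B) ∘ (antipode ⊗ id 1)) ∘ dⁿ B 1 ≈⟨ assoc ⟩
    (id 1 ⊗ δ B) ∘ (antipode ⊗ id 1) ∘ dⁿ B 1 ≈⟨ rfl ⟩∘⟨ (rfl ⟩∘⟨ CB.d¹≈d) ⟩
    (id 1 ⊗ δ B) ∘ (antipode ⊗ id 1) ∘ d B ≈˘⟨ rfl ⟩∘⟨ cup-via-antipode ⟩
    (id 1 ⊗ δ B) ∘ d A ≈˘⟨ rfl ⟩∘⟨ CA.d¹≈d ⟩
    (id 1 ⊗ μ B †) ∘ dⁿ A 1 ∎

  -- η B slides along the A-cups: by the unit relation it is an effect applied to d A.
  η-slides-cross : Sliding.Slides A (η B)
  η-slides-cross = begin
    (η B ⊗ id 0) ∘ id 0 ≈⟨ idr ⟩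
    η B ⊗ id 0 ≈⟨ ≅⇒≈ unitR≅ ⟩
    η B ≈⟨ u1 ⟩
    (ε B ⊗ id 1) ∘ δ A ∘ η A ≈⟨ assoc˘ ⟩
    ((ε B ⊗ id 1) ∘ δ A) ∘ η A ≈˘⟨ FA.effect-swap ⟩∘⟨ rfl ⟩
    ((id 1 ⊗ ε B) ∘ δ A) ∘ η A ≈⟨ assoc ⟩
    (id 1 ⊗ ε B) ∘ d A ≈˘⟨ rfl ⟩∘⟨ CA.d¹≈d ⟩
    (id 1 ⊗ η B †) ∘ dⁿ A 1 ∎

green-red : Interacting g r
green-red = record
  { bialgebra   = bialg
  ; copy-unit   = copy-η
  ; delete-mult = del-μ
  ; unit-rel    = ηr-def
  ; counit-rel  = εg-def
  }

-- The relations with the colours exchanged are the daggers of the axioms.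
bialgebra-rg : δ r ∘ μ g ≈ (μ g ⊗ μ g) ∘ ((id 1 ⊗ σ 1 1) ⊗ id 1) ∘ (δ r ⊗ δ r)
bialgebra-rg = begin
  δ r ∘ μ g ≈˘⟨ rfl ⟩∘⟨ †† ⟩
  δ r ∘ δ g † ≈˘⟨ dag∘ ⟩
  (δ g ∘ μ r) † ≈⟨ †-cong bialg ⟩
  ((μ r ⊗ μ r) ∘ ((id 1 ⊗ σ 1 1) ⊗ id 1) ∘ (δ g ⊗ δ g)) † ≈⟨ dag∘ ⟩
  (((id 1 ⊗ σ 1 1) ⊗ id 1) ∘ (δ g ⊗ δ g)) † ∘ (μ r ⊗ μ r) † ≈⟨ dag∘ ⟩∘⟨ dag⊗ ⟩
  ((δ g ⊗ δ g) † ∘ ((id 1 ⊗ σ 1 1) ⊗ id 1) †) ∘ (δ r ⊗ δ r) ≈⟨ (≈-trans dag⊗ (†† ⟩⊗⟨ ††) ⟩∘⟨ ≈-trans dag⊗ (≈-trans dag⊗ (dagid ⟩⊗⟨ σ†) ⟩⊗⟨ dagid)) ⟩∘⟨ rfl ⟩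
  ((μ g ⊗ μ g) ∘ ((id 1 ⊗ σ 1 1) ⊗ id 1)) ∘ (δ r ⊗ δ r) ≈⟨ assoc ⟩
  (μ g ⊗ μ g) ∘ ((id 1 ⊗ σ 1 1) ⊗ id 1) ∘ (δ r ⊗ δ r) ∎

copy-unit-rg : δ r ∘ η g ≈ η g ⊗ η g
copy-unit-rg = begin
  δ r ∘ η g ≈˘⟨ rfl ⟩∘⟨ †† ⟩
  δ r ∘ ε g † ≈˘⟨ dag∘ ⟩
  (ε g ∘ μ r) † ≈⟨ †-cong del-μ ⟩
  (ε g ⊗ ε g) † ≈⟨ dag⊗ ⟩
  ε g † ⊗ ε g † ≈⟨ †† ⟩⊗⟨ †† ⟩
  η g ⊗ η g ∎

delete-mult-rg : ε r ∘ μ g ≈ ε r ⊗ ε r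
delete-mult-rg = begin
  ε r ∘ μ g ≈˘⟨ rfl ⟩∘⟨ †† ⟩
  ε r ∘ δ g † ≈˘⟨ dag∘ ⟩
  (δ g ∘ η r) † ≈⟨ †-cong copy-η ⟩
  (η r ⊗ η r) † ≈⟨ dag⊗ ⟩
  ε r ⊗ ε r ∎

unit-rel-rg : η g ≈ (ε g ⊗ id 1) ∘ δ r ∘ η r
unit-rel-rg = begin
  η g ≈˘⟨ †† ⟩
  ε g † ≈⟨ †-cong εg-def ⟩
  (ε r ∘ μ r ∘ (id 1 ⊗ η g)) † ≈⟨ dag∘ ⟩
  (μ r ∘ (id 1 ⊗ η g)) † ∘ ε r † ≈⟨ dag∘ ⟩∘⟨ †† ⟩
  ((id 1 ⊗ η g) † ∘ δ r) ∘ η r ≈⟨ (≈-trans dag⊗ (dagid ⟩⊗⟨ rfl) ⟩∘⟨ rfl) ⟩∘⟨ rfl ⟩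
  ((id 1 ⊗ ε g) ∘ δ r) ∘ η r ≈⟨ Frobenius.effect-swap r ⟩∘⟨ rfl ⟩
  ((ε g ⊗ id 1) ∘ δ r) ∘ η r ≈⟨ assoc ⟩
  (ε g ⊗ id 1) ∘ δ r ∘ η r ∎

counit-rel-rg : ε r ≈ ε g ∘ μ g ∘ (id 1 ⊗ η r)
counit-rel-rg = begin
  ε r ≈⟨ †-cong ηr-def ⟩
  ((ε r ⊗ id 1) ∘ δ g ∘ η g) † ≈⟨ dag∘ ⟩
  (δ g ∘ η g) † ∘ (ε r ⊗ id 1) † ≈⟨ dag∘ ⟩∘⟨ ≈-trans dag⊗ (†† ⟩⊗⟨ dagid) ⟩
  (ε g ∘ δ g †) ∘ (η r ⊗ id 1) ≈⟨ (rfl ⟩∘⟨ ††) ⟩∘⟨ rfl ⟩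
  (ε g ∘ μ g) ∘ (η r ⊗ id 1) ≈⟨ assoc ⟩
  ε g ∘ μ g ∘ (η r ⊗ id 1) ≈˘⟨ rfl ⟩∘⟨ μ-comm g ⟩∘⟨ rfl ⟩
  ε g ∘ (μ g ∘ σ 1 1) ∘ (η r ⊗ id 1) ≈⟨ rfl ⟩∘⟨ assoc ⟩
  ε g ∘ μ g ∘ σ 1 1 ∘ (η r ⊗ id 1) ≈⟨ rfl ⟩∘⟨ rfl ⟩∘⟨ natσ ⟩
  ε g ∘ μ g ∘ (id 1 ⊗ η r) ∘ σ 0 1 ≈⟨ rfl ⟩∘⟨ rfl ⟩∘⟨ ≈-trans (rfl ⟩∘⟨ σ01) idr ⟩
  ε g ∘ μ g ∘ (id 1 ⊗ η r) ∎


red-green : Interacting r g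
red-green = record
  { bialgebra   = bialgebra-rg
  ; copy-unit   = copy-unit-rg
  ; delete-mult = delete-mult-rg
  ; unit-rel    = unit-rel-rg
  ; counit-rel  = counit-rel-rg
  }

μ-slides : ∀ c c' → Sliding.Slides c (μ c')
μ-slides g g = SmallCups.μ-slides g
μ-slides g r = Hopf.μ-slides-cross green-red
μ-slides r g = Hopf.μ-slides-cross red-green
μ-slides r r = SmallCups.μ-slides r

η-slides : ∀ c c' → Sliding.Slides c (η c')
η-slides g g = SmallCups.η-slides g
η-slides g r = Hopf.η-slides-cross green-red
η-slides r g = Hopf.η-slides-cross red-green
η-slides r r = SmallCups.η-slides r

generators-slide : ∀ c → Sliding.GeneratorsSlide c
generators-slide c = record
  { μ-slides = μ-slides c
  ; η-slides = η-slides c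
  ; σ-slides = SmallCups.σ-slides c
  ; cup-sym₁ = SmallCups.cup-sym₁ c
  ; cup-sym₂ = SmallCups.cup-sym₂ c
  }

transpose≈† : ∀ c {n m} (f : Tm n m) → transpose c f ≈ f †
transpose≈† c f = Sliding.transpose-of-sliding c (Sliding.every-morphism-slides c (generators-slide c) f)

proposition3 : ∀ {n m} (f : Tm n m) → (transpose g f ≈ f †) × (transpose r f ≈ f †)
proposition3 f = transpose≈† g f , transpose≈† r f
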